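{- Let $p$ be a prime and let $G$ be a connected $p$-periodic graph, with $p$-periodicity realized by an automorphism $h$ of order $p$, and let $\overline G$ be the quotient graph of $G$ under $\langle h\rangle$. Then $N_G(u,x,y)\equiv \big(N_{\overline G}(u,x,y)\big)^p$ modulo the ideal of $\mathbb{Z}[u,x,y]$ generated by $p$ and $u^p-u$.
   Context: Graphs are finite 1-dimensional CW-complexes (loops and multiple edges are allowed). For an integer $p\ge 2$, a graph $G$ is called $p$-periodic if its automorphism group contains an element $h$ of order $p$ such that no edge of $G$ is mapped to itself by any nontrivial element of $\langle h\rangle\cong\mathbb{Z}_p$ (the induced action on edges is fixed-point free). The quotient graph $\overline G$ is obtained by identifying all vertices in each $\langle h\rangle$-orbit to a single vertex and all edges in each $\langle h\rangle$-orbit to a single edge. For a graph $G$ with edge set $E(G)$ and $q$ edges, the Negami polynomial is $N_G(u,x,y)=\sum_{Y\subseteq E(G)} u^{w(G-Y)}x^{q-|Y|}y^{|Y|}$, where $w(G-Y)$ denotes the number of connected components of the graph $G-Y$ obtained from $G$ by removing the edges in $Y$ (keeping all vertices). -}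

module Defs where

open import Data.Nat using (ℕ; zero; suc; _+_; _∸_; _<_; _≡ᵇ_)
open import Data.Integer as ℤ using (ℤ; +_; -_)
open import Data.Bool using (Bool; true; false; _∧_; _∨_; not; if_then_else_)
open import Data.Fin using (Fin; toℕ; _≟_)
open import Data.Fin.Subset using (Subset)
open import Data.Vec using (Vec; []; _∷_; lookup; count)
open import Data.List using (List; []; _∷_; _++_; map; concatMap; foldr; allFin)
open import Data.Product using (_×_; _,_; proj₁; proj₂; ∃; ∃-syntax; Σ)
open import Data.Sum using (_⊎_)
open import Relation.Binary.PropositionalEquality using (_≡_)
open import Relation.Nullary using (¬_; does)
open import Function using (id)

record Graph : Set where
  field
    n    : ℕ
    m    : ℕ
    ends : Fin m → Fin n × Fin n
open Graph public

SameEnds : ∀ {k} → Fin k × Fin k → Fin k × Fin k → Set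
SameEnds (a , b) (c , d) = ((a ≡ c) × (b ≡ d)) ⊎ ((a ≡ d) × (b ≡ c))

iterate : ∀ {A : Set} → ℕ → (A → A) → A → A
iterate zero    f x = x
iterate (suc k) f x = f (iterate k f x)

record Automorphism (G : Graph) : Set where
  field
    fV    : Fin (n G) → Fin (n G)
    fV⁻¹  : Fin (n G) → Fin (n G)
    fE    : Fin (m G) → Fin (m G)
    fE⁻¹  : Fin (m G) → Fin (m G)
    fV-inv₁ : ∀ v → fV (fV⁻¹ v) ≡ v
    fV-inv₂ : ∀ v → fV⁻¹ (fV v) ≡ v
    fE-inv₁ : ∀ e → fE (fE⁻¹ e) ≡ e
    fE-inv₂ : ∀ e → fE⁻¹ (fE e) ≡ e
    incidence : ∀ e → SameEnds (ends G (fE e))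
                               (fV (proj₁ (ends G e)) , fV (proj₂ (ends G e)))
open Automorphism public

PowIsId : ∀ {G} → Automorphism G → ℕ → Set
PowIsId h k = (∀ v → iterate k (fV h) v ≡ v) × (∀ e → iterate k (fE h) e ≡ e)

HasOrder : ∀ {G} → Automorphism G → ℕ → Set
HasOrder h p = (0 < p) × PowIsId h p × (∀ k → 0 < k → k < p → ¬ PowIsId h k)

EdgeFree : ∀ {G} → Automorphism G → ℕ → Set
EdgeFree h p = ∀ k → 0 < k → k < p → ∀ e → ¬ (iterate k (fE h) e ≡ e)

IsPeriodicBy : (G : Graph) → Automorphism G → ℕ → Set
IsPeriodicBy G h p = HasOrder h p × EdgeFree h p

data Path (G : Graph) : Fin (n G) → Fin (n G) → Set where
  here  : ∀ {v} → Path G v v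
  fwd   : ∀ e {w} → Path G (proj₂ (ends G e)) w → Path G (proj₁ (ends G e)) w
  bwd   : ∀ e {w} → Path G (proj₁ (ends G e)) w → Path G (proj₂ (ends G e)) w

Connected : Graph → Set
Connected G = ∀ v w → Path G v w

-- Quotient graph Q of G under ⟨h⟩: vertex/edge sets of Q are in bijection
-- with ⟨h⟩-orbits (via surjections whose fibres are exactly the orbits),
-- and the edge orbit [e] joins the vertex orbits of the ends of e.
record IsQuotient (G : Graph) (h : Automorphism G) (Q : Graph) : Set where
  field
    πV : Fin (n G) → Fin (n Q)
    πE : Fin (m G) → Fin (m Q)
    πV-surj : ∀ a → ∃[ v ] πV v ≡ a
    πE-surj : ∀ b → ∃[ e ] πE e ≡ b
    πV-orbit₁ : ∀ v w → πV v ≡ πV w → ∃[ k ] iterate k (fV h) v ≡ w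
    πV-orbit₂ : ∀ v w k → iterate k (fV h) v ≡ w → πV v ≡ πV w
    πE-orbit₁ : ∀ e f → πE e ≡ πE f → ∃[ k ] iterate k (fE h) e ≡ f
    πE-orbit₂ : ∀ e f k → iterate k (fE h) e ≡ f → πE e ≡ πE f
    πE-ends : ∀ e → SameEnds (ends Q (πE e))
                             (πV (proj₁ (ends G e)) , πV (proj₂ (ends G e)))

-- Polynomials in ℤ[u,x,y], as finite lists of monomials c·u^a x^b y^c,
-- compared via their coefficient functions.

Monomial : Set
Monomial = ℤ × ℕ × ℕ × ℕ

Poly : Set
Poly = List Monomial

coeff : Poly → ℕ → ℕ → ℕ → ℤ
coeff []                  a b c = + 0
coeff ((k , i , j , l) ∷ f) a b c =
  (if (i ≡ᵇ a) ∧ (j ≡ᵇ b) ∧ (l ≡ᵇ c) then k else + 0) ℤ.+ coeff f a b c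

_≈ₚ_ : Poly → Poly → Set
f ≈ₚ g = ∀ a b c → coeff f a b c ≡ coeff g a b c

const : ℤ → Poly
const k = (k , 0 , 0 , 0) ∷ []

varU : Poly
varU = (+ 1 , 1 , 0 , 0) ∷ []

_+ₚ_ : Poly → Poly → Poly
f +ₚ g = f ++ g

-ₚ_ : Poly → Poly
-ₚ f = map (λ { (k , i , j , l) → (- k , i , j , l) }) f

_*ₚ_ : Poly → Poly → Poly
f *ₚ g = concatMap (λ { (k , i , j , l) →
           map (λ { (k' , i' , j' , l') → (k ℤ.* k' , i + i' , j + j' , l + l') }) g }) f

_^ₚ_ : Poly → ℕ → Poly
f ^ₚ zero  = const (+ 1)
f ^ₚ suc k = f *ₚ (f ^ₚ k)

CongModPU : ℕ → Poly → Poly → Set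
CongModPU p f g = ∃[ A ] ∃[ B ]
  (f +ₚ (-ₚ g)) ≈ₚ ((const (+ p) *ₚ A) +ₚ (((varU ^ₚ p) +ₚ (-ₚ varU)) *ₚ B))

allSubsets : (m : ℕ) → List (Subset m)
allSubsets zero    = [] ∷ []
allSubsets (suc m) = concatMap (λ s → (true ∷ s) ∷ (false ∷ s) ∷ []) (allSubsets m)

module _ (G : Graph) (Y : Subset (m G)) where
  adj : Fin (n G) → Fin (n G) → Bool
  adj v w = anyE (allFin (m G))
    where
      joins : Fin (m G) → Bool
      joins e = not (lookup Y e) ∧
        ((does (proj₁ (ends G e) ≟ v) ∧ does (proj₂ (ends G e) ≟ w)) ∨
         (does (proj₁ (ends G e) ≟ w) ∧ does (proj₂ (ends G e) ≟ v)))
      anyE : List (Fin (m G)) → Bool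
      anyE = foldr (λ e b → joins e ∨ b) false

  anyV : (Fin (n G) → Bool) → Bool
  anyV P = foldr (λ v b → P v ∨ b) false (allFin (n G))

  reach : ℕ → Fin (n G) → Fin (n G) → Bool
  reach zero    v w = does (v ≟ w)
  reach (suc k) v w = does (v ≟ w) ∨ anyV (λ u → adj v u ∧ reach k u w)

  -- v and w lie in the same component of G − Y (walks of length ≤ n suffice)
  sameComp : Fin (n G) → Fin (n G) → Bool
  sameComp v w = reach (n G) v w

  components : ℕ
  components = foldr (λ v k → (if isLeast v then 1 else 0) + k) 0 (allFin (n G))
    where
      isLeast : Fin (n G) → Bool
      isLeast v = not (anyV (λ u → (toℕ u Data.Nat.<ᵇ toℕ v) ∧ sameComp u v))

  sizeY : ℕ
  sizeY = count (λ b → Data.Bool._≟_ b true) Y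

Negami : Graph → Poly
Negami G = map (λ Y → (+ 1 , components G Y , m G ∸ sizeY G Y , sizeY G Y))
               (allSubsets (m G))

module Submission where

-- Since ⟨h⟩ acts freely on edges, every edge of G is h^k(ẽ) for a
-- unique slice k < p and edge ē of Q, so an edge set Y of G is the same
-- as a p-tuple (Ȳ₀, …, Ȳ_{p-1}) of edge sets of Q, and h acts on tuples
-- by rotation.  Expanding N_Q^p as a sum over such tuples, both N_G and
-- N_Q^p become sums over tuples of rotation-invariant monomials whose x-
-- and y-exponents agree.  Tuples in free rotation orbits contribute p
-- equal monomials, which vanish modulo p.  A rotation-fixed tuple is
-- constant, Y = π⁻¹(Ȳ); then each component of Q − Ȳ has one or p
-- components of G − Y over it, so w(G − Y) = F + p·D while the tuple
-- contributes u^(p·(F + D)) to N_Q^p, and u^(F + p·D) ≡ u^(F + D) ≡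
-- u^(p·(F + D)) modulo u^p − u.

open import Defs
open import Data.Nat using (ℕ; zero; suc; _+_; _*_; _∸_; _<_; _≤_; _<ᵇ_; _≡ᵇ_; s≤s; z≤n; NonZero; >-nonZero; >-nonZero⁻¹)
import Data.Nat.Properties as ℕP
open import Data.Nat.Primality using (Prime; prime⇒nonZero)
open import Data.Nat.Coprimality using (prime⇒coprime; coprime-Bézout)
import Data.Nat.GCD as GCD
open import Data.Nat.DivMod using (_%_; _/_; m≡m%n+[m/n]*n; m%n<n; m%n%n≡m%n; %-distribˡ-+; [m+n]%n≡m%n; m<n⇒m%n≡m)
open import Data.Nat.ListAction using (sum)
open import Data.Nat.ListAction.Properties using (sum-↭)
open import Data.Integer using (ℤ; +_; -_) renaming (_+_ to _+ℤ_; _*_ to _*ℤ_)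
import Data.Integer.Properties as ℤP
open import Algebra.Properties.CommutativeSemigroup ℕP.+-commutativeSemigroup using () renaming (interchange to +-interchange; x∙yz≈y∙xz to +-left-comm)
open import Algebra.Properties.CommutativeSemigroup ℤP.+-commutativeSemigroup using () renaming (interchange to +ℤ-interchange; x∙yz≈y∙xz to +ℤ-left-comm)
open import Data.Integer.Tactic.RingSolver using (solve-∀)
open import Data.Bool using (Bool; true; false; _∧_; _∨_; not; if_then_else_; T)
import Data.Bool.Properties as BP
open import Data.Unit using (tt)
open import Data.Fin as Fin using (Fin; toℕ; fromℕ<; _≟_)
import Data.Fin.Properties as FinP
open import Data.Fin.Subset using (Subset)
open import Data.Vec as Vec using (Vec; lookup; tabulate; count)
import Data.Vec.Properties as VP
open import Data.List as List using (List; []; _∷_; _++_; map; concatMap; replicate; foldr; length; filter; allFin; applyUpTo; cartesianProductWith; cartesianProduct; [_])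
import Data.List.Properties as LP
open import Data.List.Membership.Propositional using (_∈_; _∉_)
open import Data.List.Membership.Propositional.Properties using (∈-allFin; ∈-map⁺; ∈-map⁻; ∈-filter⁺; ∈-filter⁻; ∈-applyUpTo⁺; ∈-applyUpTo⁻; ∈-++⁺ˡ; ∈-++⁺ʳ; ∈-++⁻; ∈-cartesianProductWith⁺; ∈-cartesianProduct⁺)
open import Data.List.Membership.Propositional.Properties.WithK using (unique∧set⇒bag)
open import Data.List.Membership.DecPropositional using () renaming (_∈?_ to member?)
open import Data.List.Relation.Unary.Any using (here; there)
open import Data.List.Relation.Unary.All using (All; []; _∷_)
open import Data.List.Relation.Unary.All.Properties using (All¬⇒¬Any)
open import Data.List.Relation.Unary.AllPairs using () renaming (tail to unique-tail)
open import Data.List.Relation.Unary.Unique.Propositional using (Unique; []; _∷_)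
import Data.List.Relation.Unary.Unique.Propositional.Properties as Uniq
open import Data.List.Relation.Binary.Permutation.Propositional as Perm using (_↭_; ↭-refl; ↭-reflexive; ↭-sym; ↭-trans; ↭-prep)
open import Data.List.Relation.Binary.Permutation.Propositional.Properties as PermP using (↭-length; ++⁺ˡ; shifts)
open import Data.List.Relation.Binary.BagAndSetEquality using (∼bag⇒↭)
open import Data.Product using (_×_; _,_; proj₁; proj₂; ∃; ∃₂; Σ)
open import Data.Sum using (_⊎_; inj₁; inj₂)
open import Data.Empty using (⊥; ⊥-elim)
open import Function.Bundles using (mk⇔; Equivalence)
open import Relation.Binary.PropositionalEquality as Eq using (_≡_; _≢_; cong; cong₂; sym)
open import Relation.Binary.Definitions using (DecidableEquality; tri<; tri≈; tri>)
open import Relation.Nullary using (¬_; yes; no; Dec; does)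
open import Relation.Nullary.Decidable using (¬?; _×-dec_)
open import Relation.Unary using (Decidable)
open Eq.≡-Reasoning
open Equivalence using (to; from)

coeffₘ : Monomial → ℕ → ℕ → ℕ → ℤ
coeffₘ (k , i , j , l) a b c = if (i ≡ᵇ a) ∧ (j ≡ᵇ b) ∧ (l ≡ᵇ c) then k else + 0

coeff-∷ : ∀ μ f a b c → coeff (μ ∷ f) a b c ≡ coeffₘ μ a b c +ℤ coeff f a b c
coeff-∷ (k , i , j , l) f a b c = Eq.refl

coeff-++ : ∀ f g a b c → coeff (f +ₚ g) a b c ≡ coeff f a b c +ℤ coeff g a b c
coeff-++ []      g a b c = sym (ℤP.+-identityˡ _)
coeff-++ (μ ∷ f) g a b c = begin
  coeffₘ μ a b c +ℤ coeff (f ++ g) a b c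
    ≡⟨ cong (coeffₘ μ a b c +ℤ_) (coeff-++ f g a b c) ⟩
  coeffₘ μ a b c +ℤ (coeff f a b c +ℤ coeff g a b c)
    ≡⟨ ℤP.+-assoc (coeffₘ μ a b c) _ _ ⟨
  (coeffₘ μ a b c +ℤ coeff f a b c) +ℤ coeff g a b c
    ≡⟨ cong (_+ℤ coeff g a b c) (coeff-∷ μ f a b c) ⟨
  coeff (μ ∷ f) a b c +ℤ coeff g a b c ∎

coeff-neg : ∀ f a b c → coeff (-ₚ f) a b c ≡ - coeff f a b c
coeff-neg []                  a b c = Eq.refl
coeff-neg ((k , i , j , l) ∷ f) a b c =
  Eq.trans (cong₂ _+ℤ_ (if-neg ((i ≡ᵇ a) ∧ (j ≡ᵇ b) ∧ (l ≡ᵇ c))) (coeff-neg f a b c))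
           (sym (ℤP.neg-distrib-+ (coeffₘ (k , i , j , l) a b c) (coeff f a b c)))
  where
  if-neg : ∀ t → (if t then - k else + 0) ≡ - (if t then k else + 0)
  if-neg true  = Eq.refl
  if-neg false = Eq.refl

≈ₚ-trans : ∀ {f g h} → f ≈ₚ g → g ≈ₚ h → f ≈ₚ h
≈ₚ-trans f≈g g≈h a b c = Eq.trans (f≈g a b c) (g≈h a b c)

↭⇒≈ₚ : ∀ {f g} → f ↭ g → f ≈ₚ g
↭⇒≈ₚ Perm.refl                 a b c = Eq.refl
↭⇒≈ₚ (Perm.prep {xs} {ys} μ f↭g) a b c =
  Eq.trans (coeff-∷ μ xs a b c)
    (Eq.trans (cong (coeffₘ μ a b c +ℤ_) (↭⇒≈ₚ f↭g a b c)) (sym (coeff-∷ μ ys a b c)))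
↭⇒≈ₚ (Perm.swap {xs} {ys} μ ν f↭g) a b c = begin
  coeff (μ ∷ ν ∷ xs) a b c
    ≡⟨ Eq.trans (coeff-∷ μ (ν ∷ xs) a b c) (cong (coeffₘ μ a b c +ℤ_) (coeff-∷ ν xs a b c)) ⟩
  coeffₘ μ a b c +ℤ (coeffₘ ν a b c +ℤ coeff xs a b c)
    ≡⟨ cong (λ z → coeffₘ μ a b c +ℤ (coeffₘ ν a b c +ℤ z)) (↭⇒≈ₚ f↭g a b c) ⟩
  coeffₘ μ a b c +ℤ (coeffₘ ν a b c +ℤ coeff ys a b c)
    ≡⟨ +ℤ-left-comm (coeffₘ μ a b c) (coeffₘ ν a b c) (coeff ys a b c) ⟩
  coeffₘ ν a b c +ℤ (coeffₘ μ a b c +ℤ coeff ys a b c)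
    ≡⟨ Eq.trans (coeff-∷ ν (μ ∷ ys) a b c) (cong (coeffₘ ν a b c +ℤ_) (coeff-∷ μ ys a b c)) ⟨
  coeff (ν ∷ μ ∷ ys) a b c ∎
↭⇒≈ₚ (Perm.trans {xs} {ys} {zs} f↭g g↭h) = ≈ₚ-trans {xs} {ys} {zs} (↭⇒≈ₚ f↭g) (↭⇒≈ₚ g↭h)

mulₘ : Monomial → Monomial → Monomial
mulₘ (k , i , j , l) (k' , i' , j' , l') = (k *ℤ k' , i + i' , j + j' , l + l')

*-∷ : ∀ μ X B → ((μ ∷ X) *ₚ B) ≡ map (mulₘ μ) B ++ (X *ₚ B)
*-∷ (k , i , j , l) X B = Eq.refl

coeff-*-[] : ∀ X a b c → coeff (X *ₚ []) a b c ≡ + 0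
coeff-*-[] []      a b c = Eq.refl
coeff-*-[] (μ ∷ X) a b c = Eq.trans (cong (λ f → coeff f a b c) (*-∷ μ X [])) (coeff-*-[] X a b c)

coeff-*-++ : ∀ X B B' a b c →
             coeff (X *ₚ (B ++ B')) a b c ≡ coeff (X *ₚ B) a b c +ℤ coeff (X *ₚ B') a b c
coeff-*-++ []      B B' a b c = Eq.refl
coeff-*-++ (μ ∷ X) B B' a b c = begin
  coeff ((μ ∷ X) *ₚ (B ++ B')) a b c
    ≡⟨ cong (λ f → coeff f a b c) (Eq.trans (*-∷ μ X (B ++ B')) (cong (_++ (X *ₚ (B ++ B'))) (LP.map-++ (mulₘ μ) B B'))) ⟩
  coeff ((μB ++ μB') ++ (X *ₚ (B ++ B'))) a b c
    ≡⟨ coeff-++ (μB ++ μB') _ a b c ⟩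
  coeff (μB ++ μB') a b c +ℤ coeff (X *ₚ (B ++ B')) a b c
    ≡⟨ cong₂ _+ℤ_ (coeff-++ μB μB' a b c) (coeff-*-++ X B B' a b c) ⟩
  (coeff μB a b c +ℤ coeff μB' a b c) +ℤ (coeff (X *ₚ B) a b c +ℤ coeff (X *ₚ B') a b c)
    ≡⟨ +ℤ-interchange (coeff μB a b c) _ _ _ ⟩
  (coeff μB a b c +ℤ coeff (X *ₚ B) a b c) +ℤ (coeff μB' a b c +ℤ coeff (X *ₚ B') a b c)
    ≡⟨ cong₂ _+ℤ_ (Eq.trans (cong (λ f → coeff f a b c) (*-∷ μ X B)) (coeff-++ μB _ a b c))
                   (Eq.trans (cong (λ f → coeff f a b c) (*-∷ μ X B')) (coeff-++ μB' _ a b c)) ⟨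
  coeff ((μ ∷ X) *ₚ B) a b c +ℤ coeff ((μ ∷ X) *ₚ B') a b c ∎
  where
  μB  = map (mulₘ μ) B
  μB' = map (mulₘ μ) B'

map-mulₘ-neg : ∀ μ B → map (mulₘ μ) (-ₚ B) ≡ -ₚ map (mulₘ μ) B
map-mulₘ-neg μ [] = Eq.refl
map-mulₘ-neg μ@(k , i , j , l) ((k' , i' , j' , l') ∷ B) =
  cong₂ _∷_ (cong (λ z → (z , i + i' , j + j' , l + l')) (sym (ℤP.neg-distribʳ-* k k')))
            (map-mulₘ-neg μ B)

coeff-*-neg : ∀ X B a b c → coeff (X *ₚ (-ₚ B)) a b c ≡ - coeff (X *ₚ B) a b c
coeff-*-neg []      B a b c = Eq.refl
coeff-*-neg (μ ∷ X) B a b c = begin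
  coeff ((μ ∷ X) *ₚ (-ₚ B)) a b c
    ≡⟨ cong (λ f → coeff f a b c) (Eq.trans (*-∷ μ X (-ₚ B)) (cong (_++ (X *ₚ (-ₚ B))) (map-mulₘ-neg μ B))) ⟩
  coeff ((-ₚ map (mulₘ μ) B) ++ (X *ₚ (-ₚ B))) a b c
    ≡⟨ coeff-++ (-ₚ map (mulₘ μ) B) _ a b c ⟩
  coeff (-ₚ map (mulₘ μ) B) a b c +ℤ coeff (X *ₚ (-ₚ B)) a b c
    ≡⟨ cong₂ _+ℤ_ (coeff-neg (map (mulₘ μ) B) a b c) (coeff-*-neg X B a b c) ⟩
  - coeff (map (mulₘ μ) B) a b c +ℤ - coeff (X *ₚ B) a b c
    ≡⟨ ℤP.neg-distrib-+ (coeff (map (mulₘ μ) B) a b c) _ ⟨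
  - (coeff (map (mulₘ μ) B) a b c +ℤ coeff (X *ₚ B) a b c)
    ≡⟨ cong -_ (Eq.trans (cong (λ f → coeff f a b c) (*-∷ μ X B)) (coeff-++ (map (mulₘ μ) B) _ a b c)) ⟨
  - coeff ((μ ∷ X) *ₚ B) a b c ∎

coeff-replicate : ∀ n μ a b c → coeff (replicate n μ) a b c ≡ + n *ℤ coeffₘ μ a b c
coeff-replicate zero    μ a b c = Eq.refl
coeff-replicate (suc n) μ a b c = begin
  coeff (μ ∷ replicate n μ) a b c           ≡⟨ coeff-∷ μ (replicate n μ) a b c ⟩
  x +ℤ coeff (replicate n μ) a b c          ≡⟨ cong (x +ℤ_) (coeff-replicate n μ a b c) ⟩
  x +ℤ + n *ℤ x                           ≡⟨ cong (_+ℤ + n *ℤ x) (ℤP.*-identityˡ x) ⟨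
  + 1 *ℤ x +ℤ + n *ℤ x                    ≡⟨ ℤP.*-distribʳ-+ x (+ 1) (+ n) ⟨
  + suc n *ℤ x                              ∎
  where x = coeffₘ μ a b c

module ModIdeal (p : ℕ) where

  P W : Poly
  P = const (+ p)
  W = (varU ^ₚ p) +ₚ (-ₚ varU)

  record InIdeal (f : Poly) : Set where
    constructor ideal
    field
      A B       : Poly
      expansion : f ≈ₚ ((P *ₚ A) +ₚ (W *ₚ B))

  coeff-combination : ∀ A B a b c →
    coeff ((P *ₚ A) +ₚ (W *ₚ B)) a b c ≡ coeff (P *ₚ A) a b c +ℤ coeff (W *ₚ B) a b c
  coeff-combination A B = coeff-++ (P *ₚ A) (W *ₚ B)

  ideal-resp-≈ : ∀ {f g} → f ≈ₚ g → InIdeal g → InIdeal f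
  ideal-resp-≈ {f} {g} f≈g (ideal A B g≈) = ideal A B (≈ₚ-trans {f} {g} {(P *ₚ A) +ₚ (W *ₚ B)} f≈g g≈)

  ideal-[] : InIdeal []
  ideal-[] = ideal [] [] λ a b c → sym (Eq.trans (coeff-combination [] [] a b c)
                                   (cong₂ _+ℤ_ (coeff-*-[] P a b c) (coeff-*-[] W a b c)))

  ideal-++ : ∀ {f g} → InIdeal f → InIdeal g → InIdeal (f ++ g)
  ideal-++ {f} {g} (ideal A B f≈) (ideal A' B' g≈) = ideal (A ++ A') (B ++ B') λ a b c → begin
    coeff (f ++ g) a b c
      ≡⟨ coeff-++ f g a b c ⟩
    coeff f a b c +ℤ coeff g a b c
      ≡⟨ cong₂ _+ℤ_ (Eq.trans (f≈ a b c) (coeff-combination A B a b c))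
                     (Eq.trans (g≈ a b c) (coeff-combination A' B' a b c)) ⟩
    (coeff (P *ₚ A) a b c +ℤ coeff (W *ₚ B) a b c) +ℤ (coeff (P *ₚ A') a b c +ℤ coeff (W *ₚ B') a b c)
      ≡⟨ +ℤ-interchange (coeff (P *ₚ A) a b c) _ _ _ ⟩
    (coeff (P *ₚ A) a b c +ℤ coeff (P *ₚ A') a b c) +ℤ (coeff (W *ₚ B) a b c +ℤ coeff (W *ₚ B') a b c)
      ≡⟨ cong₂ _+ℤ_ (coeff-*-++ P A A' a b c) (coeff-*-++ W B B' a b c) ⟨
    coeff (P *ₚ (A ++ A')) a b c +ℤ coeff (W *ₚ (B ++ B')) a b c
      ≡⟨ coeff-combination (A ++ A') (B ++ B') a b c ⟨
    coeff ((P *ₚ (A ++ A')) +ₚ (W *ₚ (B ++ B'))) a b c ∎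

  ideal-neg : ∀ {f} → InIdeal f → InIdeal (-ₚ f)
  ideal-neg {f} (ideal A B f≈) = ideal (-ₚ A) (-ₚ B) λ a b c → begin
    coeff (-ₚ f) a b c
      ≡⟨ coeff-neg f a b c ⟩
    - coeff f a b c
      ≡⟨ cong -_ (Eq.trans (f≈ a b c) (coeff-combination A B a b c)) ⟩
    - (coeff (P *ₚ A) a b c +ℤ coeff (W *ₚ B) a b c)
      ≡⟨ ℤP.neg-distrib-+ (coeff (P *ₚ A) a b c) _ ⟩
    - coeff (P *ₚ A) a b c +ℤ - coeff (W *ₚ B) a b c
      ≡⟨ cong₂ _+ℤ_ (coeff-*-neg P A a b c) (coeff-*-neg W B a b c) ⟨
    coeff (P *ₚ (-ₚ A)) a b c +ℤ coeff (W *ₚ (-ₚ B)) a b c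
      ≡⟨ coeff-combination (-ₚ A) (-ₚ B) a b c ⟨
    coeff ((P *ₚ (-ₚ A)) +ₚ (W *ₚ (-ₚ B))) a b c ∎

  ideal-replicate : ∀ μ → InIdeal (replicate p μ)
  ideal-replicate μ@(k , i , j , l) = ideal (μ ∷ []) [] λ a b c → begin
    coeff (replicate p μ) a b c
      ≡⟨ coeff-replicate p μ a b c ⟩
    + p *ℤ coeffₘ μ a b c
      ≡⟨ scale ((i ≡ᵇ a) ∧ (j ≡ᵇ b) ∧ (l ≡ᵇ c)) ⟨
    coeffₘ (+ p *ℤ k , i , j , l) a b c
      ≡⟨ Eq.trans (ℤP.+-identityʳ _) (ℤP.+-identityʳ _) ⟨
    coeff (P *ₚ (μ ∷ [])) a b c +ℤ + 0
      ≡⟨ cong (coeff (P *ₚ (μ ∷ [])) a b c +ℤ_) (coeff-*-[] W a b c) ⟨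
    coeff (P *ₚ (μ ∷ [])) a b c +ℤ coeff (W *ₚ []) a b c
      ≡⟨ coeff-combination (μ ∷ []) [] a b c ⟨
    coeff ((P *ₚ (μ ∷ [])) +ₚ (W *ₚ [])) a b c ∎
    where
    scale : ∀ t → (if t then + p *ℤ k else + 0) ≡ + p *ℤ (if t then k else + 0)
    scale true  = Eq.refl
    scale false = sym (ℤP.*-zeroʳ (+ p))

  ideal-concatMap : ∀ {A : Set} (F : A → Poly) → (∀ x → InIdeal (F x)) → ∀ xs → InIdeal (concatMap F xs)
  ideal-concatMap F F∈ []       = ideal-[]
  ideal-concatMap F F∈ (x ∷ xs) = ideal-++ (F∈ x) (ideal-concatMap F F∈ xs)

  -- a wrapper around CongModPU p, so that both sides can be inferred
  record _≡ᵢ_ (f g : Poly) : Set where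
    constructor mk≡ᵢ
    field diff∈ideal : InIdeal (f +ₚ (-ₚ g))
  open _≡ᵢ_ public

  ≈ₚ⇒≡ᵢ : ∀ {f g} → f ≈ₚ g → f ≡ᵢ g
  ≈ₚ⇒≡ᵢ {f} {g} f≈g = mk≡ᵢ (ideal-resp-≈ (λ a b c → begin
    coeff (f ++ (-ₚ g)) a b c               ≡⟨ coeff-++ f (-ₚ g) a b c ⟩
    coeff f a b c +ℤ coeff (-ₚ g) a b c     ≡⟨ cong₂ _+ℤ_ (f≈g a b c) (coeff-neg g a b c) ⟩
    coeff g a b c +ℤ - coeff g a b c        ≡⟨ ℤP.+-inverseʳ (coeff g a b c) ⟩
    + 0                                     ∎) ideal-[])

  coeff-diff : ∀ f g a b c → coeff (f +ₚ (-ₚ g)) a b c ≡ coeff f a b c +ℤ - coeff g a b c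
  coeff-diff f g a b c = Eq.trans (coeff-++ f (-ₚ g) a b c) (cong (coeff f a b c +ℤ_) (coeff-neg g a b c))

  ≡ᵢ-sym : ∀ {f g} → f ≡ᵢ g → g ≡ᵢ f
  ≡ᵢ-sym {f} {g} (mk≡ᵢ f≡g) = mk≡ᵢ (ideal-resp-≈ (λ a b c → begin
    coeff (g ++ (-ₚ f)) a b c                    ≡⟨ coeff-diff g f a b c ⟩
    coeff g a b c +ℤ - coeff f a b c             ≡⟨ negate-diff (coeff f a b c) (coeff g a b c) ⟩
    - (coeff f a b c +ℤ - coeff g a b c)         ≡⟨ cong -_ (coeff-diff f g a b c) ⟨
    - coeff (f ++ (-ₚ g)) a b c                  ≡⟨ coeff-neg (f ++ (-ₚ g)) a b c ⟨
    coeff (-ₚ (f ++ (-ₚ g))) a b c               ∎) (ideal-neg f≡g))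
    where
    negate-diff : ∀ (x y : ℤ) → y +ℤ - x ≡ - (x +ℤ - y)
    negate-diff = solve-∀

  ≡ᵢ-trans : ∀ {f g h} → f ≡ᵢ g → g ≡ᵢ h → f ≡ᵢ h
  ≡ᵢ-trans {f} {g} {h} (mk≡ᵢ f≡g) (mk≡ᵢ g≡h) = mk≡ᵢ (ideal-resp-≈ (λ a b c → begin
    coeff (f ++ (-ₚ h)) a b c
      ≡⟨ coeff-diff f h a b c ⟩
    coeff f a b c +ℤ - coeff h a b c
      ≡⟨ telescope (coeff f a b c) (coeff g a b c) (coeff h a b c) ⟩
    (coeff f a b c +ℤ - coeff g a b c) +ℤ (coeff g a b c +ℤ - coeff h a b c)
      ≡⟨ cong₂ _+ℤ_ (coeff-diff f g a b c) (coeff-diff g h a b c) ⟨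
    coeff (f ++ (-ₚ g)) a b c +ℤ coeff (g ++ (-ₚ h)) a b c
      ≡⟨ coeff-++ (f ++ (-ₚ g)) _ a b c ⟨
    coeff ((f ++ (-ₚ g)) ++ (g ++ (-ₚ h))) a b c ∎) (ideal-++ f≡g g≡h))
    where
    telescope : ∀ (x y z : ℤ) → x +ℤ - z ≡ (x +ℤ - y) +ℤ (y +ℤ - z)
    telescope = solve-∀

  ≡ᵢ-++ : ∀ {f f' g g'} → f ≡ᵢ g → f' ≡ᵢ g' → (f ++ f') ≡ᵢ (g ++ g')
  ≡ᵢ-++ {f} {f'} {g} {g'} (mk≡ᵢ f≡g) (mk≡ᵢ f'≡g') = mk≡ᵢ (ideal-resp-≈ (λ a b c → begin
    coeff ((f ++ f') ++ (-ₚ (g ++ g'))) a b c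
      ≡⟨ coeff-diff (f ++ f') (g ++ g') a b c ⟩
    coeff (f ++ f') a b c +ℤ - coeff (g ++ g') a b c
      ≡⟨ cong₂ (λ x y → x +ℤ - y) (coeff-++ f f' a b c) (coeff-++ g g' a b c) ⟩
    (coeff f a b c +ℤ coeff f' a b c) +ℤ - (coeff g a b c +ℤ coeff g' a b c)
      ≡⟨ regroup (coeff f a b c) (coeff f' a b c) (coeff g a b c) (coeff g' a b c) ⟩
    (coeff f a b c +ℤ - coeff g a b c) +ℤ (coeff f' a b c +ℤ - coeff g' a b c)
      ≡⟨ cong₂ _+ℤ_ (coeff-diff f g a b c) (coeff-diff f' g' a b c) ⟨
    coeff (f ++ (-ₚ g)) a b c +ℤ coeff (f' ++ (-ₚ g')) a b c
      ≡⟨ coeff-++ (f ++ (-ₚ g)) _ a b c ⟨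
    coeff ((f ++ (-ₚ g)) ++ (f' ++ (-ₚ g'))) a b c ∎) (ideal-++ f≡g f'≡g'))
    where
    regroup : ∀ (x y z w : ℤ) → (x +ℤ y) +ℤ - (z +ℤ w) ≡ (x +ℤ - z) +ℤ (y +ℤ - w)
    regroup = solve-∀

  ideal⇒≡ᵢ : ∀ {f g} → InIdeal f → InIdeal g → f ≡ᵢ g
  ideal⇒≡ᵢ f∈ g∈ = mk≡ᵢ (ideal-++ f∈ (ideal-neg g∈))

  mono : ℕ → ℕ → ℕ → Poly
  mono a b c = (+ 1 , a , b , c) ∷ []

  varU-pow : ∀ k → (varU ^ₚ k) ≡ (+ 1 , k , 0 , 0) ∷ []
  varU-pow zero    = Eq.refl
  varU-pow (suc k) = cong (varU *ₚ_) (varU-pow k)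

  -- u^(p+e) − u^(1+e) = (u^p − u) · u^e
  u^p≡u : ∀ e b c → mono (p + e) b c ≡ᵢ mono (suc e) b c
  u^p≡u e b c = mk≡ᵢ (ideal [] (mono e b c) (
    Eq.subst (λ U → (mono (p + e) b c ++ (-ₚ mono (suc e) b c))
                      ≈ₚ ((P *ₚ []) ++ ((U ++ (-ₚ varU)) *ₚ mono e b c)))
             (sym (varU-pow p)) (λ a b c → Eq.refl)))

  u^pa≡u^a : ∀ a e b c → mono (p * a + e) b c ≡ᵢ mono (a + e) b c
  u^pa≡u^a zero    e b c = Eq.subst (λ z → mono (z + e) b c ≡ᵢ mono e b c)
                                      (sym (ℕP.*-zeroʳ p)) (≈ₚ⇒≡ᵢ (λ _ _ _ → Eq.refl))
  u^pa≡u^a (suc a) e b c = Eq.subst₂ (λ x y → mono x b c ≡ᵢ mono y b c) exp₁ exp₂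
    (≡ᵢ-trans (u^p≡u (p * a + e) b c) shifted)
    where
    shifted : mono (suc (p * a + e)) b c ≡ᵢ mono (a + suc e) b c
    shifted = Eq.subst (λ z → mono z b c ≡ᵢ mono (a + suc e) b c) (ℕP.+-suc (p * a) e) (u^pa≡u^a a (suc e) b c)
    exp₁ : p + (p * a + e) ≡ p * suc a + e
    exp₁ = Eq.trans (sym (ℕP.+-assoc p (p * a) e)) (cong (_+ e) (sym (ℕP.*-suc p a)))
    exp₂ : a + suc e ≡ suc a + e
    exp₂ = ℕP.+-suc a e

  ≡ᵢ⇒CongModPU : ∀ {f g} → f ≡ᵢ g → CongModPU p f g
  ≡ᵢ⇒CongModPU (mk≡ᵢ (ideal A B expansion)) = A , B , expansion

  -- u^(F + p·D) ≡ u^(p·(F + D)): both reduce to u^(F + D)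
  u-exponents : ∀ F D b c → mono (F + p * D) b c ≡ᵢ mono (p * (F + D)) b c
  u-exponents F D b c = ≡ᵢ-trans
    (Eq.subst₂ (λ x y → mono x b c ≡ᵢ mono y b c) (ℕP.+-comm (p * D) F) (ℕP.+-comm D F) (u^pa≡u^a D F b c))
    (≡ᵢ-sym (Eq.subst₂ (λ x y → mono x b c ≡ᵢ mono y b c) (ℕP.+-identityʳ _) (ℕP.+-identityʳ _) (u^pa≡u^a (F + D) 0 b c)))

-- Two duplicate-free lists with the same elements are permutations of
-- each other; this is how all the bijections below become equalities
-- of sums.
unique-↭ : ∀ {A : Set} {xs ys : List A} → Unique xs → Unique ys →
           (∀ {z} → z ∈ xs → z ∈ ys) → (∀ {z} → z ∈ ys → z ∈ xs) → xs ↭ ys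
unique-↭ xs! ys! ⊆ ⊇ = ∼bag⇒↭ (unique∧set⇒bag xs! ys! (mk⇔ ⊆ ⊇))

map-unique-on : ∀ {A B : Set} (f : A → B) {xs : List A} → Unique xs →
                (∀ {x y} → x ∈ xs → y ∈ xs → f x ≡ f y → x ≡ y) → Unique (map f xs)
map-unique-on f {[]}     []         inj = []
map-unique-on f {x ∷ xs} (x∉ ∷ xs!) inj =
  distinct xs x∉ (λ m → m) ∷ map-unique-on f xs! (λ x∈ y∈ → inj (there x∈) (there y∈))
  where
  distinct : ∀ ys → All (x ≢_) ys → (∀ {y} → y ∈ ys → y ∈ xs) → All (f x ≢_) (map f ys)
  distinct []       []          _ = []
  distinct (y ∷ ys) (x≢y ∷ x≢s) ⊆ =
    (λ fx≡fy → x≢y (inj (here Eq.refl) (there (⊆ (here Eq.refl))) fx≡fy)) ∷ distinct ys x≢s (λ m → ⊆ (there m))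

vectors : ∀ {X : Set} → List X → (k : ℕ) → List (Vec X k)
vectors xs zero    = Vec.[] ∷ []
vectors xs (suc k) = cartesianProductWith Vec._∷_ xs (vectors xs k)

vectors-unique : ∀ {X : Set} (xs : List X) k → Unique xs → Unique (vectors xs k)
vectors-unique xs zero    xs! = [] ∷ []
vectors-unique xs (suc k) xs! =
  Uniq.cartesianProductWith⁺ Vec._∷_ VP.∷-injective xs! (vectors-unique xs k xs!)

vectors-complete : ∀ {X : Set} (xs : List X) k → (∀ x → x ∈ xs) → ∀ t → t ∈ vectors xs k
vectors-complete xs zero    all∈ Vec.[]       = here Eq.refl
vectors-complete xs (suc k) all∈ (x Vec.∷ t) =
  ∈-cartesianProductWith⁺ Vec._∷_ (all∈ x) (vectors-complete xs k all∈ t)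

allSubsets-cartesian : ∀ m → allSubsets (suc m) ≡
                       cartesianProductWith (λ s b → b Vec.∷ s) (allSubsets m) (true ∷ false ∷ [])
allSubsets-cartesian m = go (allSubsets m)
  where
  go : ∀ ss → List.concatMap (λ s → (true Vec.∷ s) ∷ (false Vec.∷ s) ∷ []) ss
              ≡ cartesianProductWith (λ s b → b Vec.∷ s) ss (true ∷ false ∷ [])
  go []       = Eq.refl
  go (s ∷ ss) = cong (λ r → (true Vec.∷ s) ∷ (false Vec.∷ s) ∷ r) (go ss)

allSubsets-unique : ∀ m → Unique (allSubsets m)
allSubsets-unique zero    = [] ∷ []
allSubsets-unique (suc m) = Eq.subst Unique (sym (allSubsets-cartesian m))
  (Uniq.cartesianProductWith⁺ (λ s b → b Vec.∷ s) (λ e → VP.∷-injectiveʳ e , VP.∷-injectiveˡ e)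
     (allSubsets-unique m) (((λ ()) ∷ []) ∷ [] ∷ []))

allSubsets-complete : ∀ m (s : Subset m) → s ∈ allSubsets m
allSubsets-complete zero    Vec.[]       = here Eq.refl
allSubsets-complete (suc m) (b Vec.∷ s) = Eq.subst ((b Vec.∷ s) ∈_) (sym (allSubsets-cartesian m))
  (∈-cartesianProductWith⁺ (λ s b → b Vec.∷ s) (allSubsets-complete m s) (both b))
  where
  both : ∀ b → b ∈ true ∷ false ∷ []
  both true  = here Eq.refl
  both false = there (here Eq.refl)

true≢false : true ≢ false
true≢false ()

countᵇ : ∀ {X : Set} → (X → Bool) → List X → ℕ
countᵇ f = foldr (λ x k → (if f x then 1 else 0) + k) 0

countᵇ-≤-length : ∀ {X : Set} (f : X → Bool) xs → countᵇ f xs ≤ length xs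
countᵇ-≤-length f []       = z≤n
countᵇ-≤-length f (x ∷ xs) with f x
... | true  = s≤s (countᵇ-≤-length f xs)
... | false = ℕP.m≤n⇒m≤1+n (countᵇ-≤-length f xs)

countᵇ-mono : ∀ {X : Set} (f g : X → Bool) xs → (∀ x → f x ≡ true → g x ≡ true) → countᵇ f xs ≤ countᵇ g xs
countᵇ-mono f g []       f⇒g = z≤n
countᵇ-mono f g (x ∷ xs) f⇒g with f x in fx | g x in gx
... | true  | true  = s≤s (countᵇ-mono f g xs f⇒g)
... | true  | false = ⊥-elim (true≢false (Eq.trans (sym (f⇒g x fx)) gx))
... | false | true  = ℕP.m≤n⇒m≤1+n (countᵇ-mono f g xs f⇒g)
... | false | false = countᵇ-mono f g xs f⇒g

countᵇ-strict : ∀ {X : Set} (f g : X → Bool) xs → (∀ x → f x ≡ true → g x ≡ true) →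
                ∀ {x} → x ∈ xs → f x ≡ false → g x ≡ true → suc (countᵇ f xs) ≤ countᵇ g xs
countᵇ-strict f g (x ∷ xs) f⇒g (here Eq.refl) fx gx rewrite fx | gx = s≤s (countᵇ-mono f g xs f⇒g)
countᵇ-strict f g (y ∷ xs) f⇒g (there x∈) fx gx with f y in fy | g y in gy
... | true  | true  = s≤s (countᵇ-strict f g xs f⇒g x∈ fx gx)
... | true  | false = ⊥-elim (true≢false (Eq.trans (sym (f⇒g y fy)) gy))
... | false | true  = ℕP.m≤n⇒m≤1+n (countᵇ-strict f g xs f⇒g x∈ fx gx)
... | false | false = countᵇ-strict f g xs f⇒g x∈ fx gx

countᵇ-filter : ∀ {X : Set} (f : X → Bool) {P : X → Set} (P? : Decidable P) →
                (∀ x → f x ≡ true → P x) → (∀ x → P x → f x ≡ true) →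
                ∀ xs → countᵇ f xs ≡ length (filter P? xs)
countᵇ-filter f P? f⇒P P⇒f []       = Eq.refl
countᵇ-filter f P? f⇒P P⇒f (x ∷ xs) with f x in fx | P? x
... | true  | yes _  = cong suc (countᵇ-filter f P? f⇒P P⇒f xs)
... | true  | no ¬Px = ⊥-elim (¬Px (f⇒P x fx))
... | false | yes Px = ⊥-elim (true≢false (Eq.trans (sym (P⇒f x Px)) fx))
... | false | no _   = countᵇ-filter f P? f⇒P P⇒f xs

countᵇ-↭ : ∀ {X : Set} (f : X → Bool) {xs ys} → xs ↭ ys → countᵇ f xs ≡ countᵇ f ys
countᵇ-↭ f Perm.refl         = Eq.refl
countᵇ-↭ f (Perm.prep x xs↭) = cong (_+_ (if f x then 1 else 0)) (countᵇ-↭ f xs↭)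
countᵇ-↭ f (Perm.swap {xs} x y xs↭) =
  Eq.trans (+-left-comm (χ x) (χ y) (countᵇ f xs)) (cong (λ k → χ y + (χ x + k)) (countᵇ-↭ f xs↭))
  where χ = λ z → if f z then 1 else 0
countᵇ-↭ f (Perm.trans xs↭ ↭zs) = Eq.trans (countᵇ-↭ f xs↭) (countᵇ-↭ f ↭zs)

countᵇ-cong : ∀ {X : Set} {f g : X → Bool} → (∀ x → f x ≡ g x) → ∀ xs → countᵇ f xs ≡ countᵇ g xs
countᵇ-cong f≗g []       = Eq.refl
countᵇ-cong f≗g (x ∷ xs) = cong₂ (λ b k → (if b then 1 else 0) + k) (f≗g x) (countᵇ-cong f≗g xs)

countᵇ-map : ∀ {X Z : Set} (f : X → Bool) (g : Z → X) zs → countᵇ f (map g zs) ≡ countᵇ (λ z → f (g z)) zs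
countᵇ-map f g []       = Eq.refl
countᵇ-map f g (z ∷ zs) = cong (_+_ (if f (g z) then 1 else 0)) (countᵇ-map f g zs)

countᵇ-++ : ∀ {X : Set} (f : X → Bool) xs ys → countᵇ f (xs ++ ys) ≡ countᵇ f xs + countᵇ f ys
countᵇ-++ f []       ys = Eq.refl
countᵇ-++ f (x ∷ xs) ys = Eq.trans (cong (_+_ (if f x then 1 else 0)) (countᵇ-++ f xs ys))
                                   (sym (ℕP.+-assoc (if f x then 1 else 0) _ _))

countᵇ-cartesian : ∀ {X Z : Set} (f : X × Z → Bool) xs zs →
                   countᵇ f (cartesianProduct xs zs) ≡ sum (map (λ x → countᵇ (λ z → f (x , z)) zs) xs)
countᵇ-cartesian f []       zs = Eq.refl
countᵇ-cartesian f (x ∷ xs) zs =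
  Eq.trans (countᵇ-++ f (map (x ,_) zs) _)
           (cong₂ _+_ (countᵇ-map f (x ,_) zs) (countᵇ-cartesian f xs zs))

countᵇ-complement : ∀ {X : Set} (f : X → Bool) xs → countᵇ f xs + countᵇ (λ x → not (f x)) xs ≡ length xs
countᵇ-complement f []       = Eq.refl
countᵇ-complement f (x ∷ xs) with f x
... | true  = cong suc (countᵇ-complement f xs)
... | false = Eq.trans (ℕP.+-suc _ _) (cong suc (countᵇ-complement f xs))

countᵇ-allFin-suc : ∀ {n} (f : Fin (suc n) → Bool) →
                    countᵇ f (List.tabulate Fin.suc) ≡ countᵇ (λ i → f (Fin.suc i)) (allFin n)
countᵇ-allFin-suc {n} f = Eq.trans (cong (countᵇ f) (sym (LP.map-tabulate (λ i → i) Fin.suc)))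
                                   (countᵇ-map f Fin.suc (allFin n))

count≡countᵇ : ∀ {n} (Y : Subset n) → count (λ b → b BP.≟ true) Y ≡ countᵇ (lookup Y) (allFin n)
count≡countᵇ Vec.[]           = Eq.refl
count≡countᵇ (true  Vec.∷ Y) = cong suc (Eq.trans (count≡countᵇ Y) (sym (countᵇ-allFin-suc (lookup (true Vec.∷ Y)))))
count≡countᵇ (false Vec.∷ Y) = Eq.trans (count≡countᵇ Y) (sym (countᵇ-allFin-suc (lookup (false Vec.∷ Y))))

sumV : ∀ {X : Set} {k} → (X → ℕ) → Vec X k → ℕ
sumV g Vec.[]       = 0
sumV g (x Vec.∷ t) = g x + sumV g t

sumV-lookup : ∀ {X : Set} {k} (g : X → ℕ) (t : Vec X k) → sumV g t ≡ sum (map (λ i → g (lookup t i)) (allFin k))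
sumV-lookup g Vec.[] = Eq.refl
sumV-lookup {k = suc k} g (x Vec.∷ t) = cong (_+_ (g x)) (Eq.trans (sumV-lookup g t)
  (cong sum (Eq.trans (LP.map-tabulate (λ i → i) (λ i → g (lookup t i)))
                      (sym (LP.map-tabulate Fin.suc (λ i → g (lookup (x Vec.∷ t) i)))))))

sumV-replicate : ∀ {X : Set} (g : X → ℕ) k (x : X) → sumV g (Vec.replicate k x) ≡ k * g x
sumV-replicate g zero    x = Eq.refl
sumV-replicate g (suc k) x = cong (_+_ (g x)) (sumV-replicate g k x)

sumV-cong : ∀ {X : Set} {k} {g g' : X → ℕ} → (∀ x → g x ≡ g' x) → (t : Vec X k) → sumV g t ≡ sumV g' t
sumV-cong g≗g' Vec.[]       = Eq.refl
sumV-cong g≗g' (x Vec.∷ t) = cong₂ _+_ (g≗g' x) (sumV-cong g≗g' t)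

∸-count≡countᵇ-not : ∀ {n} (Y : Subset n) → n ∸ count (λ b → b BP.≟ true) Y ≡ countᵇ (λ i → not (lookup Y i)) (allFin n)
∸-count≡countᵇ-not {n} Y = begin
  n ∸ count (λ b → b BP.≟ true) Y
    ≡⟨ cong₂ _∸_ (sym (Eq.trans (countᵇ-complement (lookup Y) (allFin n)) (LP.length-tabulate (λ i → i))))
                 (count≡countᵇ Y) ⟩
  (countᵇ (lookup Y) (allFin n) + countᵇ (λ i → not (lookup Y i)) (allFin n)) ∸ countᵇ (lookup Y) (allFin n)
    ≡⟨ ℕP.m+n∸m≡n (countᵇ (lookup Y) (allFin n)) _ ⟩
  countᵇ (λ i → not (lookup Y i)) (allFin n) ∎

module _ {A : Set} (σ : A → A) where

  iterate-+ : ∀ a b x → iterate (a + b) σ x ≡ iterate a σ (iterate b σ x)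
  iterate-+ zero    b x = Eq.refl
  iterate-+ (suc a) b x = cong σ (iterate-+ a b x)

  iterate-suc : ∀ a x → iterate (suc a) σ x ≡ iterate a σ (σ x)
  iterate-suc a x = Eq.trans (cong (λ k → iterate k σ x) (ℕP.+-comm 1 a)) (iterate-+ a 1 x)

  iterate-* : ∀ c k x → iterate k σ x ≡ x → iterate (c * k) σ x ≡ x
  iterate-* zero    k x σᵏx≡x = Eq.refl
  iterate-* (suc c) k x σᵏx≡x =
    Eq.trans (iterate-+ k (c * k) x) (Eq.trans (cong (iterate k σ) (iterate-* c k x σᵏx≡x)) σᵏx≡x)

  iterate-fixed : ∀ k x → σ x ≡ x → iterate k σ x ≡ x
  iterate-fixed zero    x σx≡x = Eq.refl
  iterate-fixed (suc k) x σx≡x = Eq.trans (cong σ (iterate-fixed k x σx≡x)) σx≡x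

  -- If σ^p x = x for a prime p and σ^k x = x for some 0 < k < p, then
  -- σ x = x: by Bézout, 1 + b·k = a·p or 1 + a·p = b·k.
  prime-period-fixed : ∀ p → Prime p → ∀ k x → 0 < k → k < p →
                       iterate p σ x ≡ x → iterate k σ x ≡ x → σ x ≡ x
  prime-period-fixed p p-prime k x 0<k k<p σᵖx≡x σᵏx≡x
    with coprime-Bézout (prime⇒coprime p-prime {{>-nonZero 0<k}} k<p)
  ... | GCD.Bézout.+- a b 1+bk≡ap =
    Eq.trans (cong σ (sym (iterate-* b k x σᵏx≡x)))
             (Eq.trans (cong (λ n → iterate n σ x) 1+bk≡ap) (iterate-* a p x σᵖx≡x))
  ... | GCD.Bézout.-+ a b 1+ap≡bk =
    Eq.trans (cong σ (sym (iterate-* a p x σᵖx≡x)))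
             (Eq.trans (cong (λ n → iterate n σ x) 1+ap≡bk) (iterate-* b k x σᵏx≡x))

module Orbits {A : Set} (_≟_ : DecidableEquality A) (σ : A → A) (p : ℕ) (p-prime : Prime p) where

  instance
    p≢0 : NonZero p
    p≢0 = prime⇒nonZero p-prime

  Periodic : A → Set
  Periodic x = iterate p σ x ≡ x

  orbit : A → List A
  orbit x = applyUpTo (λ k → iterate k σ x) p

  iterate-mod : ∀ k x → Periodic x → iterate k σ x ≡ iterate (k % p) σ x
  iterate-mod k x per = Eq.trans (cong (λ n → iterate n σ x) (m≡m%n+[m/n]*n k p))
    (Eq.trans (iterate-+ σ (k % p) ((k / p) * p) x) (cong (iterate (k % p) σ) (iterate-* σ (k / p) p x per)))

  ∈-orbit : ∀ k x → Periodic x → iterate k σ x ∈ orbit x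
  ∈-orbit k x per = Eq.subst (_∈ orbit x) (sym (iterate-mod k x per))
                             (∈-applyUpTo⁺ (λ k → iterate k σ x) (m%n<n k p))

  orbit-∈ : ∀ {x y} → y ∈ orbit x → ∃ λ k → y ≡ iterate k σ x
  orbit-∈ {x} y∈ with ∈-applyUpTo⁻ (λ k → iterate k σ x) y∈
  ... | k , _ , y≡ = k , y≡

  length-orbit : ∀ x → length (orbit x) ≡ p
  length-orbit x = LP.length-applyUpTo (λ k → iterate k σ x) p

  orbit-unique : ∀ x → Periodic x → σ x ≢ x → Unique (orbit x)
  orbit-unique x per σx≢x = Uniq.applyUpTo⁺₁ (λ k → iterate k σ x) p distinct
    where
    distinct : ∀ {i j} → i < j → j < p → iterate i σ x ≢ iterate j σ x
    distinct {i} {j} i<j j<p σⁱx≡σʲx = σx≢x σx≡x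
      where
      y = iterate i σ x
      σʲ⁻ⁱy≡y : iterate (j ∸ i) σ y ≡ y
      σʲ⁻ⁱy≡y = Eq.trans (sym (iterate-+ σ (j ∸ i) i x))
        (Eq.trans (cong (λ n → iterate n σ x) (ℕP.m∸n+n≡m (ℕP.<⇒≤ i<j))) (sym σⁱx≡σʲx))
      σy≡y : σ y ≡ y
      σy≡y = prime-period-fixed σ p p-prime (j ∸ i) y (ℕP.m<n⇒0<n∸m i<j)
        (ℕP.≤-<-trans (ℕP.m∸n≤m j i) j<p)
        (Eq.trans (sym (iterate-+ σ p i x)) (Eq.trans (cong (λ n → iterate n σ x) (ℕP.+-comm p i))
                  (Eq.trans (iterate-+ σ i p x) (cong (iterate i σ) per))))
        σʲ⁻ⁱy≡y
      x≡y : x ≡ y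
      x≡y = begin
        x                                  ≡⟨ per ⟨
        iterate p σ x                      ≡⟨ cong (λ n → iterate n σ x) (ℕP.m∸n+n≡m i≤p) ⟨
        iterate (p ∸ i + i) σ x            ≡⟨ iterate-+ σ (p ∸ i) i x ⟩
        iterate (p ∸ i) σ y                ≡⟨ iterate-fixed σ (p ∸ i) y σy≡y ⟩
        y                                  ∎
        where i≤p = ℕP.<⇒≤ (ℕP.<-trans i<j j<p)
      σx≡x : σ x ≡ x
      σx≡x = Eq.trans (cong σ x≡y) (Eq.trans σy≡y (sym x≡y))

  map-orbit : ∀ {B : Set} (f : A → B) → (∀ y → f (σ y) ≡ f y) → ∀ x → map f (orbit x) ≡ replicate p (f x)
  map-orbit {B} f f∘σ≗f x = Eq.trans (LP.map-applyUpTo (λ k → iterate k σ x) f p) (constant p (λ k → invariant k x))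
    where
    invariant : ∀ k y → f (iterate k σ y) ≡ f y
    invariant zero    y = Eq.refl
    invariant (suc k) y = Eq.trans (f∘σ≗f _) (invariant k y)
    constant : ∀ n {g : ℕ → B} → (∀ k → g k ≡ f x) → applyUpTo g n ≡ replicate n (f x)
    constant zero    g≡ = Eq.refl
    constant (suc n) g≡ = Eq.cong₂ _∷_ (g≡ 0) (constant n (λ k → g≡ (suc k)))

  Closed : List A → Set
  Closed L = ∀ {y} → y ∈ L → σ y ∈ L

  record Decomposition (L : List A) : Set where
    field
      fixedPoints : List A
      freeOrbits  : List A
      splitting   : L ↭ fixedPoints ++ concatMap orbit freeOrbits
      allFixed    : All (λ x → σ x ≡ x) fixedPoints

  private
    σ⁻¹ : A → A
    σ⁻¹ = iterate (p ∸ 1) σ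

    σ⁻¹∘σ : ∀ y → Periodic y → σ⁻¹ (σ y) ≡ y
    σ⁻¹∘σ y per = Eq.trans (sym (iterate-suc σ (p ∸ 1) y))
      (Eq.trans (cong (λ n → iterate n σ y) (ℕP.suc-pred p)) per)

    closed-iterate : ∀ {L} → Closed L → ∀ k {y} → y ∈ L → iterate k σ y ∈ L
    closed-iterate closed zero    y∈ = y∈
    closed-iterate closed (suc k) y∈ = closed (closed-iterate closed k y∈)

    drop-fixed : ∀ x L → All (x ≢_) L → Closed (x ∷ L) → (∀ {y} → y ∈ x ∷ L → Periodic y) →
                 σ x ≡ x → Closed L
    drop-fixed x L x∉L closed per σx≡x {y} y∈ with closed (there y∈)
    ... | there σy∈ = σy∈
    ... | here σy≡x = ⊥-elim (All¬⇒¬Any x∉L (Eq.subst (_∈ L) y≡x y∈))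
      where
      y≡x : y ≡ x
      y≡x = Eq.trans (sym (σ⁻¹∘σ y (per (there y∈))))
              (Eq.trans (cong σ⁻¹ σy≡x) (iterate-fixed σ (p ∸ 1) x σx≡x))

    module RemoveOrbit (x : A) (L : List A) (x∷L! : Unique (x ∷ L)) (closed : Closed (x ∷ L))
                       (per : ∀ {y} → y ∈ x ∷ L → Periodic y) (σx≢x : σ x ≢ x) where

      outside? : ∀ y → Dec (y ∉ orbit x)
      outside? y = ¬? (member? _≟_ y (orbit x))

      rest : List A
      rest = filter outside? L

      rest⊆L : ∀ {y} → y ∈ rest → y ∈ L × y ∉ orbit x
      rest⊆L = ∈-filter⁻ outside? {xs = L}

      orbit⊆ : ∀ {y} → y ∈ orbit x → y ∈ x ∷ L
      orbit⊆ y∈ with orbit-∈ y∈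
      ... | k , Eq.refl = closed-iterate closed k (here Eq.refl)

      splitting : x ∷ L ↭ orbit x ++ rest
      splitting = unique-↭ x∷L! (Uniq.++⁺ (orbit-unique x (per (here Eq.refl)) σx≢x)
                                          (Uniq.filter⁺ outside? (unique-tail x∷L!)) disjoint) ⊆ ⊇
        where
        disjoint : ∀ {y} → y ∈ orbit x × y ∈ rest → ⊥
        disjoint (y∈o , y∈r) = proj₂ (rest⊆L y∈r) y∈o
        ⊆ : ∀ {y} → y ∈ x ∷ L → y ∈ orbit x ++ rest
        ⊆ {y} y∈ with member? _≟_ y (orbit x) | y∈
        ... | yes y∈o | _          = ∈-++⁺ˡ y∈o
        ... | no  y∉o | here y≡x   = ⊥-elim (y∉o (Eq.subst (_∈ orbit x) (sym y≡x) (∈-orbit 0 x (per (here Eq.refl)))))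
        ... | no  y∉o | there y∈L  = ∈-++⁺ʳ (orbit x) (∈-filter⁺ outside? y∈L y∉o)
        ⊇ : ∀ {y} → y ∈ orbit x ++ rest → y ∈ x ∷ L
        ⊇ y∈ with ∈-++⁻ (orbit x) y∈
        ... | inj₁ y∈o = orbit⊆ y∈o
        ... | inj₂ y∈r = there (proj₁ (rest⊆L y∈r))

      shorter : ∀ {n} → length L ≤ n → length rest ≤ n
      shorter {n} |L|≤n = ℕP.≤-trans (ℕP.m≤n+m (length rest) (p ∸ 1))
                                     (ℕP.+-cancelˡ-≤ 1 _ _ (Eq.subst (_≤ suc n) |x∷L| (s≤s |L|≤n)))
        where
        |x∷L| : length (x ∷ L) ≡ 1 + ((p ∸ 1) + length rest)
        |x∷L| = Eq.trans (↭-length splitting) (Eq.trans (LP.length-++ (orbit x))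
                  (cong (_+ length rest) (Eq.trans (length-orbit x) (sym (ℕP.suc-pred p)))))

      -- the orbit of x is closed under σ⁻¹ as well, so its complement is closed
      rest-closed : Closed rest
      rest-closed {y} y∈ with rest⊆L y∈
      ... | y∈L , y∉o with closed (there y∈L)
      ... | here σy≡x = ⊥-elim (y∉o (Eq.subst (_∈ orbit x) (σ⁻¹∘σ y (per (there y∈L)))
                                        (Eq.subst (λ z → σ⁻¹ z ∈ orbit x) (sym σy≡x) (∈-orbit (p ∸ 1) x (per (here Eq.refl))))))
      ... | there σy∈L = ∈-filter⁺ outside? σy∈L
              (λ σy∈o → y∉o (Eq.subst (_∈ orbit x) (σ⁻¹∘σ y (per (there y∈L))) (σ⁻¹-orbit σy∈o)))
        where
        σ⁻¹-orbit : ∀ {z} → z ∈ orbit x → σ⁻¹ z ∈ orbit x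
        σ⁻¹-orbit z∈ with orbit-∈ z∈
        ... | k , Eq.refl = Eq.subst (_∈ orbit x) (iterate-+ σ (p ∸ 1) k x) (∈-orbit (p ∸ 1 + k) x (per (here Eq.refl)))

    decompose-bounded : ∀ n L → length L ≤ n → Unique L → Closed L → (∀ {y} → y ∈ L → Periodic y) → Decomposition L
    decompose-bounded n [] _ _ _ _ = record { fixedPoints = [] ; freeOrbits = [] ; splitting = ↭-refl ; allFixed = [] }
    decompose-bounded (suc n) (x ∷ L) (s≤s |L|≤n) L!@(x∉L ∷ L!') closed per with σ x ≟ x
    ... | yes σx≡x =
      record { fixedPoints = x ∷ fixedPoints ; freeOrbits = freeOrbits
             ; splitting = ↭-prep x splitting ; allFixed = σx≡x ∷ allFixed }
      where open Decomposition (decompose-bounded n L |L|≤n L!' (drop-fixed x L x∉L closed per σx≡x) (λ y∈ → per (there y∈)))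
    ... | no σx≢x =
      record { fixedPoints = fixedPoints ; freeOrbits = x ∷ freeOrbits
             ; splitting = ↭-trans R.splitting (↭-trans (++⁺ˡ (orbit x) splitting) (shifts (orbit x) fixedPoints))
             ; allFixed = allFixed }
      where
      module R = RemoveOrbit x L L! closed per σx≢x
      open Decomposition (decompose-bounded n R.rest (R.shorter |L|≤n) (Uniq.filter⁺ R.outside? L!')
                                            R.rest-closed (λ y∈ → per (there (proj₁ (R.rest⊆L y∈)))))

  decompose : ∀ L → Unique L → Closed L → (∀ {y} → y ∈ L → Periodic y) → Decomposition L
  decompose L = decompose-bounded (length L) L ℕP.≤-refl

-- Sums over a set with an action of prime order p.  If f and g are
-- invariant monomial-valued functions that agree modulo (p, u^p − u) at
-- the fixed points, then Σ f ≡ Σ g: every free orbit contributes p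
-- equal monomials, which lie in the ideal.
module OrbitSums {A : Set} (_≟_ : DecidableEquality A) (σ : A → A) (p : ℕ) (p-prime : Prime p) where
  open Orbits _≟_ σ p p-prime
  open ModIdeal p

  orbit-sum : ∀ (L : List A) → Unique L → Closed L → (∀ y → Periodic y) →
              (f g : A → Monomial) → (∀ y → f (σ y) ≡ f y) → (∀ y → g (σ y) ≡ g y) →
              (∀ y → σ y ≡ y → (f y ∷ []) ≡ᵢ (g y ∷ [])) → map f L ≡ᵢ map g L
  orbit-sum L L! closed periodic f g f-inv g-inv fixed≡ =
    ≡ᵢ-trans (≈ₚ⇒≡ᵢ (↭⇒≈ₚ (by-orbits f f-inv)))
             (≡ᵢ-trans (≡ᵢ-++ (on-fixed fixedPoints allFixed) (ideal⇒≡ᵢ (free f) (free g)))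
                       (≈ₚ⇒≡ᵢ (↭⇒≈ₚ (↭-sym (by-orbits g g-inv)))))
    where
    open Decomposition (decompose L L! closed (λ {y} _ → periodic y))

    by-orbits : ∀ k → (∀ y → k (σ y) ≡ k y) →
                map k L ↭ map k fixedPoints ++ concatMap (λ d → List.replicate p (k d)) freeOrbits
    by-orbits k k-inv = Eq.subst (map k L ↭_)
      (Eq.trans (LP.map-++ k fixedPoints _) (cong (map k fixedPoints ++_)
        (Eq.trans (LP.map-concatMap k orbit freeOrbits) (LP.concatMap-cong (map-orbit k k-inv) freeOrbits))))
      (PermP.map⁺ k splitting)

    free : ∀ k → InIdeal (concatMap (λ d → List.replicate p (k d)) freeOrbits)
    free k = ideal-concatMap _ (λ d → ideal-replicate (k d)) freeOrbits

    on-fixed : ∀ Fs → All (λ y → σ y ≡ y) Fs → map f Fs ≡ᵢ map g Fs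
    on-fixed []       []               = ≈ₚ⇒≡ᵢ (λ _ _ _ → Eq.refl)
    on-fixed (y ∷ Fs) (σy≡y ∷ allFixed) = ≡ᵢ-++ (fixed≡ y σy≡y) (on-fixed Fs allFixed)

SameEnds-sym : ∀ {k} {x y : Fin k × Fin k} → SameEnds x y → SameEnds y x
SameEnds-sym (inj₁ (a , b)) = inj₁ (sym a , sym b)
SameEnds-sym (inj₂ (a , b)) = inj₂ (sym b , sym a)

SameEnds-trans : ∀ {k} {x y z : Fin k × Fin k} → SameEnds x y → SameEnds y z → SameEnds x z
SameEnds-trans (inj₁ (a , b)) (inj₁ (c , d)) = inj₁ (Eq.trans a c , Eq.trans b d)
SameEnds-trans (inj₁ (a , b)) (inj₂ (c , d)) = inj₂ (Eq.trans a c , Eq.trans b d)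
SameEnds-trans (inj₂ (a , b)) (inj₁ (c , d)) = inj₂ (Eq.trans a d , Eq.trans b c)
SameEnds-trans (inj₂ (a , b)) (inj₂ (c , d)) = inj₁ (Eq.trans a d , Eq.trans b c)

SameEnds-swap : ∀ {k} (v w : Fin k) → SameEnds (v , w) (w , v)
SameEnds-swap v w = inj₂ (Eq.refl , Eq.refl)

SameEnds-map : ∀ {k k'} (f : Fin k → Fin k') {x y : Fin k × Fin k} → SameEnds x y →
               SameEnds (f (proj₁ x) , f (proj₂ x)) (f (proj₁ y) , f (proj₂ y))
SameEnds-map f (inj₁ (a , b)) = inj₁ (cong f a , cong f b)
SameEnds-map f (inj₂ (a , b)) = inj₂ (cong f a , cong f b)

does-sound : ∀ {A : Set} (d : Dec A) → T (does d) → A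
does-sound (yes a) _ = a

does-complete : ∀ {A : Set} (d : Dec A) → A → T (does d)
does-complete (yes _) _ = tt
does-complete (no ¬a) a = ¬a a

module _ {X : Set} (P : X → Bool) where

  anyᵇ : List X → Bool
  anyᵇ = foldr (λ x b → P x ∨ b) false

  anyᵇ⁻ : ∀ xs → T (anyᵇ xs) → ∃ λ x → T (P x)
  anyᵇ⁻ (x ∷ xs) t with to BP.T-∨ t
  ... | inj₁ Px = x , Px
  ... | inj₂ t' = anyᵇ⁻ xs t'

  anyᵇ⁺ : ∀ {x xs} → x ∈ xs → T (P x) → T (anyᵇ xs)
  anyᵇ⁺ {xs = y ∷ xs} (here Eq.refl) Px = from BP.T-∨ (inj₁ Px)
  anyᵇ⁺ {xs = y ∷ xs} (there x∈)     Px = from BP.T-∨ (inj₂ (anyᵇ⁺ x∈ Px))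

module Components (G : Graph) (Y : Subset (m G)) where

  V : Set
  V = Fin (n G)

  N : ℕ
  N = n G

  record Adj (v w : V) : Set where
    constructor mkAdj
    field adjacent : T (adj G Y v w)

  Adj-intro : ∀ {v w} e → lookup Y e ≡ false → SameEnds (ends G e) (v , w) → Adj v w
  Adj-intro {v} {w} e Ye≡false ends≈ = mkAdj (anyᵇ⁺ _ (∈-allFin e)
    (from BP.T-∧ (from BP.T-not-≡ Ye≡false , from BP.T-∨ (joins ends≈))))
    where
    tested : ∀ {a b x y : V} → a ≡ x → b ≡ y → T (does (a ≟ x) ∧ does (b ≟ y))
    tested {a} {b} {x} {y} a≡x b≡y = from BP.T-∧ (does-complete (a ≟ x) a≡x , does-complete (b ≟ y) b≡y)
    joins : SameEnds (ends G e) (v , w) → _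
    joins (inj₁ (a , b)) = inj₁ (tested a b)
    joins (inj₂ (a , b)) = inj₂ (tested a b)

  Adj-elim : ∀ {v w} → Adj v w → ∃ λ e → lookup Y e ≡ false × SameEnds (ends G e) (v , w)
  Adj-elim {v} {w} (mkAdj t) with anyᵇ⁻ _ (allFin (m G)) t
  ... | e , t' with to BP.T-∧ t'
  ... | Ye , ends? = e , to BP.T-not-≡ Ye , endpoints (to BP.T-∨ ends?)
    where
    tested : ∀ {a b x y : V} → T (does (a ≟ x) ∧ does (b ≟ y)) → a ≡ x × b ≡ y
    tested {a} {b} {x} {y} t = let (a≡ , b≡) = to BP.T-∧ t in does-sound (a ≟ x) a≡ , does-sound (b ≟ y) b≡
    endpoints : _ → SameEnds (ends G e) (v , w)
    endpoints (inj₁ t) = inj₁ (tested t)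
    endpoints (inj₂ t) = inj₂ (tested t)

  Adj-sym : ∀ {v w} → Adj v w → Adj w v
  Adj-sym a with Adj-elim a
  ... | e , Ye , ends≈ = Adj-intro e Ye (SameEnds-trans ends≈ (SameEnds-swap _ _))

  infixr 5 _∷_
  data Walk : V → V → Set where
    []  : ∀ {v} → Walk v v
    _∷_ : ∀ {v u w} → Adj v u → Walk u w → Walk v w

  _++ʷ_ : ∀ {u v w} → Walk u v → Walk v w → Walk u w
  []      ++ʷ q = q
  (a ∷ r) ++ʷ q = a ∷ (r ++ʷ q)

  reverseʷ : ∀ {v w} → Walk v w → Walk w v
  reverseʷ []      = []
  reverseʷ (a ∷ r) = reverseʷ r ++ʷ (Adj-sym a ∷ [])

  record Reach (k : ℕ) (v w : V) : Set where
    constructor mkReach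
    field reachable : T (reach G Y k v w)

  reach-refl : ∀ k v → Reach k v v
  reach-refl zero    v = mkReach (does-complete (v ≟ v) Eq.refl)
  reach-refl (suc k) v = mkReach (from BP.T-∨ (inj₁ (does-complete (v ≟ v) Eq.refl)))

  reach-step : ∀ {k v u w} → Adj v u → Reach k u w → Reach (suc k) v w
  reach-step {u = u} (mkAdj a) (mkReach r) =
    mkReach (from BP.T-∨ (inj₂ (anyᵇ⁺ _ (∈-allFin u) (from BP.T-∧ (a , r)))))

  reach-inv : ∀ {k v w} → Reach (suc k) v w → v ≡ w ⊎ ∃ λ u → Adj v u × Reach k u w
  reach-inv {v = v} {w} (mkReach r) with to BP.T-∨ r
  ... | inj₁ v≡w = inj₁ (does-sound (v ≟ w) v≡w)
  ... | inj₂ t with anyᵇ⁻ _ (allFin N) t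
  ...   | u , t' = let (a , r') = to BP.T-∧ t' in inj₂ (u , mkAdj a , mkReach r')

  reach⇒walk : ∀ k {v w} → Reach k v w → Walk v w
  reach⇒walk zero {v} {w} (mkReach r) with Eq.refl ← does-sound (v ≟ w) r = []
  reach⇒walk (suc k) r with reach-inv r
  ... | inj₁ Eq.refl        = []
  ... | inj₂ (u , a , r') = a ∷ reach⇒walk k r'

  walk⇒reach : ∀ {v w} → Walk v w → ∃ λ k → Reach k v w
  walk⇒reach []      = 0 , reach-refl 0 _
  walk⇒reach (a ∷ r) = let (k , r') = walk⇒reach r in suc k , reach-step a r'

  reach-suc : ∀ k {v w} → Reach k v w → Reach (suc k) v w
  reach-suc zero {v} {w} r with Eq.refl ← does-sound (v ≟ w) (Reach.reachable r) = reach-refl 1 _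
  reach-suc (suc k) r with reach-inv r
  ... | inj₁ Eq.refl      = reach-refl (suc (suc k)) _
  ... | inj₂ (u , a , r') = reach-step a (reach-suc k r')

  reach-≤ : ∀ {k k' v w} → k ≤ k' → Reach k v w → Reach k' v w
  reach-≤ {k} {k'} {v} {w} k≤k' r = Eq.subst (λ n → Reach n v w) (ℕP.m∸n+n≡m k≤k') (go (k' ∸ k))
    where
    go : ∀ d → Reach (d + k) v w
    go zero    = r
    go (suc d) = reach-suc (d + k) (go d)

  -- Reachability stabilises after N = n G steps: the set of vertices
  -- reaching w grows strictly until it stops changing, and it has at
  -- most N elements.
  module Stabilisation (w : V) where

    reaching : ℕ → V → Bool
    reaching k v = reach G Y k v w

    size : ℕ → ℕ
    size k = countᵇ (reaching k) (allFin N)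

    Stable : ℕ → Set
    Stable j = ∀ v → reaching (suc j) v ≡ reaching j v

    -- once stable, always stable: step j + 2 is computed from step j + 1
    -- exactly as step j + 1 is from step j
    stable-suc : ∀ j → Stable j → Stable (suc j)
    stable-suc j st v = cong (does (v ≟ w) ∨_) (go (allFin N))
      where
      go : ∀ us → anyᵇ (λ u → adj G Y v u ∧ reaching (suc j) u) us ≡ anyᵇ (λ u → adj G Y v u ∧ reaching j u) us
      go []       = Eq.refl
      go (u ∷ us) = Eq.cong₂ _∨_ (cong (adj G Y v u ∧_) (st u)) (go us)

    stable-+ : ∀ j → Stable j → ∀ i v → reaching (i + j) v ≡ reaching j v
    stable-+ j st zero    v = Eq.refl
    stable-+ j st (suc i) v = Eq.trans (stable-at i v) (stable-+ j st i v)
      where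
      stable-at : ∀ i → Stable (i + j)
      stable-at zero    = st
      stable-at (suc i) = stable-suc (i + j) (stable-at i)

    mono : ∀ k v → reaching k v ≡ true → reaching (suc k) v ≡ true
    mono k v r = to BP.T-≡ (Reach.reachable (reach-suc k (mkReach (from BP.T-≡ r))))

    stabilised-or-growing : ∀ k → (∃ λ j → j ≤ k × Stable j) ⊎ (suc k ≤ size k)
    stabilised-or-growing zero = inj₂ (Eq.subst (λ z → suc z ≤ size 0) (none (allFin N))
      (countᵇ-strict (λ _ → false) (reaching 0) (allFin N) (λ _ ()) (∈-allFin w) Eq.refl
                     (to BP.T-≡ (Reach.reachable (reach-refl 0 w)))))
      where
      none : ∀ (vs : List V) → countᵇ (λ _ → false) vs ≡ 0
      none []       = Eq.refl
      none (_ ∷ vs) = none vs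
    stabilised-or-growing (suc k) with stabilised-or-growing k
    ... | inj₁ (j , j≤k , st) = inj₁ (j , ℕP.m≤n⇒m≤1+n j≤k , st)
    ... | inj₂ grown with FinP.any? (λ v → (reaching (suc k) v BP.≟ true) ×-dec (reaching k v BP.≟ false))
    ...   | yes (v , new , old) = inj₂ (ℕP.≤-trans (s≤s grown)
              (countᵇ-strict (reaching k) (reaching (suc k)) (allFin N) (mono k) (∈-allFin v) old new))
    ...   | no no-new = inj₁ (k , ℕP.n≤1+n k , stable)
      where
      stable : Stable k
      stable v with reaching (suc k) v in new | reaching k v in old
      ... | true  | true  = Eq.refl
      ... | false | false = Eq.refl
      ... | true  | false = ⊥-elim (no-new (v , new , old))
      ... | false | true  = ⊥-elim (true≢false (Eq.trans (sym (mono k v old)) new))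

    reach-N : ∀ {k v} → Reach k v w → Reach N v w
    reach-N {k} {v} r with stabilised-or-growing N
    ... | inj₂ N<size = ⊥-elim (ℕP.<⇒≱ (ℕP.≤-trans N<size (countᵇ-≤-length (reaching N) (allFin N)))
                                          (ℕP.≤-reflexive (LP.length-tabulate {n = N} (λ i → i))))
    ... | inj₁ (j , j≤N , st) with ℕP.≤-total k N
    ...   | inj₁ k≤N = reach-≤ k≤N r
    ...   | inj₂ N≤k = reach-≤ j≤N (mkReach (Eq.subst T k-steps≡j-steps (Reach.reachable r)))
      where
      k-steps≡j-steps : reaching k v ≡ reaching j v
      k-steps≡j-steps = Eq.trans (cong (λ i → reaching i v) (sym (ℕP.m∸n+n≡m (ℕP.≤-trans j≤N N≤k))))
                                 (stable-+ j st (k ∸ j) v)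

  walk⇒sameComp : ∀ {v w} → Walk v w → T (sameComp G Y v w)
  walk⇒sameComp {w = w} p = let (k , r) = walk⇒reach p in Reach.reachable (Stabilisation.reach-N w r)

  walk? : ∀ v w → Dec (Walk v w)
  walk? v w with sameComp G Y v w in same
  ... | true  = yes (reach⇒walk N (mkReach (Eq.subst T (sym same) tt)))
  ... | false = no (λ p → Eq.subst T same (walk⇒sameComp p))

  Least : (V → Set) → V → Set
  Least P u = P u × (∀ u' → toℕ u' < toℕ u → ¬ P u')

  least-unique : ∀ {P u u'} → Least P u → Least P u' → u ≡ u'
  least-unique (Pu , u-least) (Pu' , u'-least) with ℕP.<-cmp (toℕ _) (toℕ _)
  ... | tri< u<u' _ _ = ⊥-elim (u'-least _ u<u' Pu)
  ... | tri≈ _ u≡u' _ = FinP.toℕ-injective u≡u'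
  ... | tri> _ _ u>u' = ⊥-elim (u-least _ u>u' Pu')

  least-below : ∀ bound (P : V → Set) → Decidable P → ∀ v → toℕ v < bound → P v → Σ V (Least P)
  least-below (suc bound) P P? v v<b Pv with FinP.any? (λ u → (toℕ u ℕP.<? toℕ v) ×-dec P? u)
  ... | yes (u , u<v , Pu) = least-below bound P P? u (ℕP.<-≤-trans u<v (ℕP.≤-pred v<b)) Pu
  ... | no  none-below     = v , Pv , λ u u<v Pu → none-below (u , u<v , Pu)

  ρ-least : ∀ v → Σ V (Least (λ u → Walk u v))
  ρ-least v = least-below (suc (toℕ v)) (λ u → Walk u v) (λ u → walk? u v) v ℕP.≤-refl []

  ρ : V → V
  ρ v = proj₁ (ρ-least v)

  ρ-walk : ∀ v → Walk (ρ v) v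
  ρ-walk v = proj₁ (proj₂ (ρ-least v))

  ρ-resp : ∀ {v w} → Walk v w → ρ v ≡ ρ w
  ρ-resp {v} {w} p = least-unique (ρ-walk v ++ʷ p , λ u u<ρv q → proj₂ (proj₂ (ρ-least v)) u u<ρv (q ++ʷ reverseʷ p))
                                  (proj₂ (ρ-least w))

  ρ-walk-≡ : ∀ {v w} → ρ v ≡ ρ w → Walk v w
  ρ-walk-≡ {v} {w} ρv≡ρw = reverseʷ (ρ-walk v) ++ʷ Eq.subst (λ u → Walk u w) (sym ρv≡ρw) (ρ-walk w)

  IsRep : V → Set
  IsRep v = ρ v ≡ v

  ρ-rep : ∀ v → IsRep (ρ v)
  ρ-rep v = ρ-resp (ρ-walk v)

  reps : List V
  reps = filter (λ v → ρ v ≟ v) (allFin N)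

  reps-unique : Unique reps
  reps-unique = Uniq.filter⁺ (λ v → ρ v ≟ v) (Uniq.allFin⁺ N)

  rep∈reps : ∀ {v} → IsRep v → v ∈ reps
  rep∈reps r = ∈-filter⁺ (λ v → ρ v ≟ v) (∈-allFin _) r

  reps-rep : ∀ {v} → v ∈ reps → IsRep v
  reps-rep v∈ = proj₂ (∈-filter⁻ (λ v → ρ v ≟ v) {xs = allFin N} v∈)

  components≡reps : components G Y ≡ length reps
  components≡reps = countᵇ-filter _ (λ v → ρ v ≟ v) least⇒rep rep⇒least (allFin N)
    where
    smaller-linked : V → V → Bool
    smaller-linked v u = (toℕ u <ᵇ toℕ v) ∧ sameComp G Y u v
    least⇒rep : ∀ v → not (anyᵇ (smaller-linked v) (allFin N)) ≡ true → IsRep v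
    least⇒rep v none = least-unique (proj₂ (ρ-least v)) ([] , λ u u<v p →
      Eq.subst T (to BP.T-not-≡ (from BP.T-≡ none))
        (anyᵇ⁺ (smaller-linked v) (∈-allFin u) (from BP.T-∧ (ℕP.<⇒<ᵇ u<v , walk⇒sameComp p))))
    rep⇒least : ∀ v → IsRep v → not (anyᵇ (smaller-linked v) (allFin N)) ≡ true
    rep⇒least v ρv≡v with anyᵇ (smaller-linked v) (allFin N) in found
    ... | false = Eq.refl
    ... | true with anyᵇ⁻ (smaller-linked v) (allFin N) (Eq.subst T (sym found) tt)
    ...   | u , t = let (u<v , same) = to BP.T-∧ t in
      ⊥-elim (proj₂ (proj₂ (ρ-least v)) u (Eq.subst (λ z → toℕ u < toℕ z) (sym ρv≡v) (ℕP.<ᵇ⇒< _ _ u<v))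
                                          (reach⇒walk N (mkReach same)))

module _ {G₁ : Graph} {Y₁ : Subset (m G₁)} {G₂ : Graph} {Y₂ : Subset (m G₂)} where
  private
    module C₁ = Components G₁ Y₁
    module C₂ = Components G₂ Y₂

  walk-map : (g : Fin (n G₁) → Fin (n G₂)) → (∀ {v w} → C₁.Adj v w → C₂.Adj (g v) (g w)) →
             ∀ {v w} → C₁.Walk v w → C₂.Walk (g v) (g w)
  walk-map g g-adj C₁.[]      = C₂.[]
  walk-map g g-adj (a C₁.∷ r) = g-adj a C₂.∷ walk-map g g-adj r

  -- If g reflects and preserves being joined by a walk, and every vertex
  -- of G₂ − Y₂ is joined to an image of g, then g induces a bijection
  -- between components, so the two graphs have equally many.
  components-bijection : (g : Fin (n G₁) → Fin (n G₂)) →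
    (∀ {v w} → C₁.Walk v w → C₂.Walk (g v) (g w)) → (∀ {v w} → C₂.Walk (g v) (g w) → C₁.Walk v w) →
    (∀ x → ∃ λ v → C₂.Walk (g v) x) → components G₁ Y₁ ≡ components G₂ Y₂
  components-bijection g preserve reflect onto =
    Eq.trans C₁.components≡reps (Eq.trans (sym (LP.length-map ḡ C₁.reps))
             (Eq.trans (↭-length (unique-↭ (map-unique-on ḡ C₁.reps-unique injective) C₂.reps-unique ⊆ ⊇))
                       (sym C₂.components≡reps)))
    where
    ḡ : Fin (n G₁) → Fin (n G₂)
    ḡ v = C₂.ρ (g v)
    injective : ∀ {x y} → x ∈ C₁.reps → y ∈ C₁.reps → ḡ x ≡ ḡ y → x ≡ y
    injective x∈ y∈ ḡx≡ḡy = Eq.trans (sym (C₁.reps-rep x∈))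
      (Eq.trans (C₁.ρ-resp (reflect (C₂.ρ-walk-≡ ḡx≡ḡy))) (C₁.reps-rep y∈))
    ⊆ : ∀ {z} → z ∈ map ḡ C₁.reps → z ∈ C₂.reps
    ⊆ z∈ with ∈-map⁻ ḡ z∈
    ... | x , _ , Eq.refl = C₂.rep∈reps (C₂.ρ-rep (g x))
    ⊇ : ∀ {z} → z ∈ C₂.reps → z ∈ map ḡ C₁.reps
    ⊇ {z} z∈ with onto z
    ... | v , p = Eq.subst (_∈ map ḡ C₁.reps)
                    (Eq.trans (C₂.ρ-resp (preserve (C₁.ρ-walk v) C₂.++ʷ p)) (C₂.reps-rep z∈))
                    (∈-map⁺ ḡ (C₁.rep∈reps (C₁.ρ-rep v)))

module _ {A B : Set} (_≟_ : DecidableEquality B) (f : A → B) where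

  fibre : List A → B → List A
  fibre L u = filter (λ x → f x ≟ u) L

  private
    δ : B → B → ℕ
    δ y u = if does (y ≟ u) then 1 else 0

    sum-δ-absent : ∀ y (U : List B) → y ∉ U → sum (map (δ y) U) ≡ 0
    sum-δ-absent y []      _   = Eq.refl
    sum-δ-absent y (u ∷ U) y∉ with y ≟ u
    ... | yes Eq.refl = ⊥-elim (y∉ (here Eq.refl))
    ... | no _        = sum-δ-absent y U (λ y∈ → y∉ (there y∈))

    sum-δ : ∀ y (U : List B) → Unique U → y ∈ U → sum (map (δ y) U) ≡ 1
    sum-δ y (u ∷ U) (u∉ ∷ U!) (here Eq.refl) with y ≟ y
    ... | yes _ = cong suc (sum-δ-absent y U (All¬⇒¬Any u∉))
    ... | no y≢y = ⊥-elim (y≢y Eq.refl)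
    sum-δ y (u ∷ U) (u∉ ∷ U!) (there y∈) with y ≟ u
    ... | yes Eq.refl = ⊥-elim (All¬⇒¬Any u∉ y∈)
    ... | no _        = sum-δ y U U! y∈

    sum-map-+ : ∀ {C : Set} (g k : C → ℕ) (U : List C) →
                sum (map (λ u → g u + k u) U) ≡ sum (map g U) + sum (map k U)
    sum-map-+ g k []      = Eq.refl
    sum-map-+ g k (u ∷ U) = Eq.trans (cong (_+_ (g u + k u)) (sum-map-+ g k U))
                                     (+-interchange (g u) (k u) (sum (map g U)) (sum (map k U)))

    |fibre-∷| : ∀ x L u → length (fibre (x ∷ L) u) ≡ δ (f x) u + length (fibre L u)
    |fibre-∷| x L u with f x ≟ u
    ... | yes _ = Eq.refl
    ... | no _  = Eq.refl

  length-by-fibres : ∀ (L : List A) (U : List B) → Unique U → (∀ {x} → x ∈ L → f x ∈ U) →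
                     length L ≡ sum (map (λ u → length (fibre L u)) U)
  length-by-fibres []      U U! _   = sym (zeros U)
    where zeros : ∀ (U : List B) → sum (map (λ _ → 0) U) ≡ 0
          zeros []      = Eq.refl
          zeros (_ ∷ U) = zeros U
  length-by-fibres (x ∷ L) U U! f∈ = sym (begin
    sum (map (λ u → length (fibre (x ∷ L) u)) U)
      ≡⟨ cong sum (LP.map-cong (|fibre-∷| x L) U) ⟩
    sum (map (λ u → δ (f x) u + length (fibre L u)) U)
      ≡⟨ sum-map-+ (δ (f x)) (λ u → length (fibre L u)) U ⟩
    sum (map (δ (f x)) U) + sum (map (λ u → length (fibre L u)) U)
      ≡⟨ cong₂ _+_ (sum-δ (f x) U U! (f∈ (here Eq.refl))) (sym (length-by-fibres L U U! (λ x∈ → f∈ (there x∈)))) ⟩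
    suc (length L) ∎)

sum-of-1-or-p : ∀ {B : Set} (p : ℕ) (g : B → ℕ) (U : List B) → (∀ {u} → u ∈ U → g u ≡ 1 ⊎ g u ≡ p) →
                ∃₂ λ F D → sum (map g U) ≡ F + p * D × length U ≡ F + D
sum-of-1-or-p p g []      _     = 0 , 0 , sym (ℕP.*-zeroʳ p) , Eq.refl
sum-of-1-or-p p g (u ∷ U) 1-or-p with sum-of-1-or-p p g U (λ u∈ → 1-or-p (there u∈)) | 1-or-p (here Eq.refl)
... | F , D , Σ≡ , |U|≡ | inj₁ gu≡1 = suc F , D , cong₂ _+_ gu≡1 Σ≡ , cong suc |U|≡
... | F , D , Σ≡ , |U|≡ | inj₂ gu≡p = F , suc D , Eq.trans (cong₂ _+_ gu≡p Σ≡) (regroup F D) ,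
                                        Eq.trans (cong suc |U|≡) (sym (ℕP.+-suc F D))
  where
  regroup : ∀ F D → p + (F + p * D) ≡ F + p * suc D
  regroup F D = Eq.trans (ℕP.+-comm p _) (Eq.trans (ℕP.+-assoc F (p * D) p)
                  (cong (_+_ F) (Eq.trans (ℕP.+-comm (p * D) p) (sym (ℕP.*-suc p D)))))

automorphism-adj : ∀ (G : Graph) (h : Automorphism G) {Y₁ Y₂ : Subset (m G)} →
  (∀ e → lookup Y₁ e ≡ lookup Y₂ (fE h e)) →
  ∀ {v w} → Components.Adj G Y₁ v w → Components.Adj G Y₂ (fV h v) (fV h w)
automorphism-adj G h {Y₁} {Y₂} Y₁≡Y₂∘h a with Components.Adj-elim G Y₁ a
... | e , Ye , ends≈ = Components.Adj-intro G Y₂ (fE h e) (Eq.trans (sym (Y₁≡Y₂∘h e)) Ye)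
                                              (SameEnds-trans (incidence h e) (SameEnds-map (fV h) ends≈))

components-automorphism : (G : Graph) (h : Automorphism G) (Y₁ Y₂ : Subset (m G)) →
  (∀ e → lookup Y₁ e ≡ lookup Y₂ (fE h e)) → components G Y₁ ≡ components G Y₂
components-automorphism G h Y₁ Y₂ Y₁≡Y₂∘h =
  components-bijection (fV h) (walk-map (fV h) (automorphism-adj G h Y₁≡Y₂∘h)) reflect onto
  where
  module C₁ = Components G Y₁
  module C₂ = Components G Y₂

  h⁻¹-adj : ∀ {v w} → C₂.Adj v w → C₁.Adj (fV⁻¹ h v) (fV⁻¹ h w)
  h⁻¹-adj {v} {w} a with C₂.Adj-elim a
  ... | e , Ye , ends≈ = C₁.Adj-intro e' (Eq.trans (Y₁≡Y₂∘h e') (Eq.trans (cong (lookup Y₂) (fE-inv₁ h e)) Ye))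
      (SameEnds-trans (inj₁ (sym (fV-inv₂ h _) , sym (fV-inv₂ h _)))
        (SameEnds-map (fV⁻¹ h) (SameEnds-trans (SameEnds-sym (incidence h e'))
          (Eq.subst (λ d → SameEnds (ends G d) (v , w)) (sym (fE-inv₁ h e)) ends≈))))
    where e' = fE⁻¹ h e

  reflect : ∀ {v w} → C₂.Walk (fV h v) (fV h w) → C₁.Walk v w
  reflect {v} {w} p = Eq.subst₂ C₁.Walk (fV-inv₂ h v) (fV-inv₂ h w) (walk-map (fV⁻¹ h) h⁻¹-adj p)

  onto : ∀ x → ∃ λ v → C₂.Walk (fV h v) x
  onto x = fV⁻¹ h x , Eq.subst (λ y → C₂.Walk y x) (sym (fV-inv₁ h x)) C₂.[]

-- The map
-- π sends components of G − Y onto components of Q − Ȳ; the preimage of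
-- each component of Q − Ȳ is an orbit of ⟨h⟩ acting on components of
-- G − Y, so it consists of 1 or p components.  Hence w(G − Y) = F + p·D
-- and w(Q − Ȳ) = F + D.
module QuotientComponents (p : ℕ) (p-prime : Prime p) (G : Graph) (h : Automorphism G)
                          (hᵖ≡id : ∀ v → iterate p (fV h) v ≡ v) (Q : Graph) (quotient : IsQuotient G h Q) where
  open IsQuotient quotient

  lift : Subset (m Q) → Subset (m G)
  lift Ȳ = tabulate (λ e → lookup Ȳ (πE e))

  iterate-incidence : ∀ k e → SameEnds (ends G (iterate k (fE h) e))
                                        (iterate k (fV h) (proj₁ (ends G e)) , iterate k (fV h) (proj₂ (ends G e)))
  iterate-incidence zero    e = inj₁ (Eq.refl , Eq.refl)
  iterate-incidence (suc k) e = SameEnds-trans (incidence h (iterate k (fE h) e)) (SameEnds-map (fV h) (iterate-incidence k e))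

  module _ (Ȳ : Subset (m Q)) where
    private
      Y = lift Ȳ
      module CG = Components G Y
      module CQ = Components Q Ȳ

      lift-lookup : ∀ e → lookup Y e ≡ lookup Ȳ (πE e)
      lift-lookup e = VP.lookup∘tabulate _ e

      π-adj : ∀ {v w} → CG.Adj v w → CQ.Adj (πV v) (πV w)
      π-adj a with CG.Adj-elim a
      ... | e , Ye , ends≈ = CQ.Adj-intro (πE e) (Eq.trans (sym (lift-lookup e)) Ye)
                                          (SameEnds-trans (πE-ends e) (SameEnds-map πV ends≈))

      π-walk : ∀ {v w} → CG.Walk v w → CQ.Walk (πV v) (πV w)
      π-walk = walk-map πV π-adj

      lift-adj : ∀ {v x̄} → CQ.Adj (πV v) x̄ → ∃ λ u → πV u ≡ x̄ × CG.Adj v u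
      lift-adj {v} {x̄} a with CQ.Adj-elim a
      ... | ē , Yē , ends≈ with πE-surj ē
      ... | e , Eq.refl = lift-ends (SameEnds-trans (SameEnds-sym (πE-ends e)) ends≈)
        where
        a₀ = proj₁ (ends G e)
        b₀ = proj₂ (ends G e)
        present : ∀ k → lookup Y (iterate k (fE h) e) ≡ false
        present k = Eq.trans (lift-lookup _) (Eq.trans (cong (lookup Ȳ) (sym (πE-orbit₂ e _ k Eq.refl))) Yē)
        lift-ends : SameEnds (πV a₀ , πV b₀) (πV v , x̄) → ∃ λ u → πV u ≡ x̄ × CG.Adj v u
        lift-ends (inj₁ (a≡ , b≡)) with πV-orbit₁ a₀ v a≡
        ... | k , hᵏa≡v = iterate k (fV h) b₀ , Eq.trans (sym (πV-orbit₂ b₀ _ k Eq.refl)) b≡ ,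
                          CG.Adj-intro (iterate k (fE h) e) (present k) (SameEnds-trans (iterate-incidence k e) (inj₁ (hᵏa≡v , Eq.refl)))
        lift-ends (inj₂ (a≡ , b≡)) with πV-orbit₁ b₀ v b≡
        ... | k , hᵏb≡v = iterate k (fV h) a₀ , Eq.trans (sym (πV-orbit₂ a₀ _ k Eq.refl)) a≡ ,
                          CG.Adj-intro (iterate k (fE h) e) (present k) (SameEnds-trans (iterate-incidence k e) (inj₂ (Eq.refl , hᵏb≡v)))

      lift-walk : ∀ {v x̄} → CQ.Walk (πV v) x̄ → ∃ λ u → πV u ≡ x̄ × CG.Walk v u
      lift-walk CQ.[]      = _ , Eq.refl , CG.[]
      lift-walk (a CQ.∷ r) with lift-adj a
      ... | u , Eq.refl , a' with lift-walk r
      ...   | u' , πu'≡ , r' = u' , πu'≡ , a' CG.∷ r'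

      lift-linked : ∀ {v w} → CQ.Walk (πV v) (πV w) → ∃ λ i → CG.Walk v (iterate i (fV h) w)
      lift-linked r with lift-walk r
      ... | u , πu≡πw , r' with πV-orbit₁ _ _ (sym πu≡πw)
      ...   | i , hⁱw≡u = i , Eq.subst (CG.Walk _) (sym hⁱw≡u) r'

      -- h permutes the components of G − Y: σ on representatives
      σ : Fin (n G) → Fin (n G)
      σ r = CG.ρ (fV h r)

      -- Y is h-invariant, so h maps walks of G − Y to walks of G − Y
      h-walk : ∀ {v w} → CG.Walk v w → CG.Walk (fV h v) (fV h w)
      h-walk = walk-map (fV h) (automorphism-adj G h λ e →
        Eq.trans (lift-lookup e) (Eq.trans (cong (lookup Ȳ) (πE-orbit₂ e (fE h e) 1 Eq.refl)) (sym (lift-lookup (fE h e)))))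

      σ-iterate : ∀ i r → CG.IsRep r → iterate i σ r ≡ CG.ρ (iterate i (fV h) r)
      σ-iterate zero    r r-rep = sym r-rep
      σ-iterate (suc i) r r-rep =
        Eq.trans (cong σ (σ-iterate i r r-rep)) (CG.ρ-resp (h-walk (CG.ρ-walk (iterate i (fV h) r))))

      σ-periodic : ∀ r → CG.IsRep r → iterate p σ r ≡ r
      σ-periodic r r-rep = Eq.trans (σ-iterate p r r-rep) (Eq.trans (cong CG.ρ (hᵖ≡id r)) r-rep)

      σ-rep : ∀ k r → CG.IsRep r → CG.IsRep (iterate k σ r)
      σ-rep zero    r r-rep = r-rep
      σ-rep (suc k) r r-rep = CG.ρ-rep _

      below : Fin (n G) → Fin (n Q)
      below r = CQ.ρ (πV r)

      below-σ : ∀ k r → below (iterate k σ r) ≡ below r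
      below-σ zero    r = Eq.refl
      below-σ (suc k) r = Eq.trans (CQ.ρ-resp (π-walk (CG.ρ-walk (fV h _)) CQ.++ʷ
                                     Eq.subst (CQ.Walk (πV (fV h _))) (sym (πV-orbit₂ _ _ 1 Eq.refl)) CQ.[]))
                                   (below-σ k r)

      same-below : ∀ {r r'} → CG.IsRep r → CG.IsRep r' → below r ≡ below r' → ∃ λ i → r' ≡ iterate i σ r
      same-below {r} {r'} r-rep r'-rep r≡r' with lift-linked {r'} {r} (CQ.ρ-walk-≡ (sym r≡r'))
      ... | i , walk = i , Eq.trans (sym r'-rep) (Eq.trans (CG.ρ-resp walk) (sym (σ-iterate i r r-rep)))

      some-above : ∀ q → CQ.IsRep q → ∃ λ r → CG.IsRep r × below r ≡ q
      some-above q q-rep with πV-surj q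
      ... | v , πv≡q = CG.ρ v , CG.ρ-rep v , Eq.trans (CQ.ρ-resp (π-walk (CG.ρ-walk v))) (Eq.trans (cong CQ.ρ πv≡q) q-rep)

      open Orbits Fin._≟_ σ p p-prime using (orbit; orbit-unique; length-orbit; ∈-orbit; orbit-∈)

      above : Fin (n Q) → List (Fin (n G))
      above = fibre Fin._≟_ below CG.reps

      above-unique : ∀ q → Unique (above q)
      above-unique q = Uniq.filter⁺ (λ r → below r Fin.≟ q) CG.reps-unique

      ∈-above⁻ : ∀ {q r} → r ∈ above q → CG.IsRep r × below r ≡ q
      ∈-above⁻ r∈ = let (r∈reps , r↦q) = ∈-filter⁻ (λ r → below r Fin.≟ _) {xs = CG.reps} r∈
                    in CG.reps-rep r∈reps , r↦q

      ∈-above⁺ : ∀ {q r} → CG.IsRep r → below r ≡ q → r ∈ above q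
      ∈-above⁺ r-rep r↦q = ∈-filter⁺ (λ r → below r Fin.≟ _) (CG.rep∈reps r-rep) r↦q

      -- the components over q form one σ-orbit: a fixed point or p of them
      |above| : ∀ q → CQ.IsRep q → length (above q) ≡ 1 ⊎ length (above q) ≡ p
      |above| q q-rep with some-above q q-rep
      ... | r , r-rep , r↦q with σ r Fin.≟ r
      ... | yes σr≡r = inj₁ (↭-length (unique-↭ (above-unique q) ([] ∷ []) ⊆ ⊇))
        where
        ⊆ : ∀ {z} → z ∈ above q → z ∈ [ r ]
        ⊆ z∈ with ∈-above⁻ z∈
        ... | z-rep , z↦q with same-below r-rep z-rep (Eq.trans r↦q (sym z↦q))
        ...   | i , z≡ = here (Eq.trans z≡ (iterate-fixed σ i r σr≡r))
        ⊇ : ∀ {z} → z ∈ [ r ] → z ∈ above q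
        ⊇ (here Eq.refl) = ∈-above⁺ r-rep r↦q
      ... | no σr≢r = inj₂ (Eq.trans (↭-length (unique-↭ (above-unique q) (orbit-unique r (σ-periodic r r-rep) σr≢r) ⊆ ⊇))
                                     (length-orbit r))
        where
        ⊆ : ∀ {z} → z ∈ above q → z ∈ orbit r
        ⊆ z∈ with ∈-above⁻ z∈
        ... | z-rep , z↦q with same-below r-rep z-rep (Eq.trans r↦q (sym z↦q))
        ...   | i , Eq.refl = ∈-orbit i r (σ-periodic r r-rep)
        ⊇ : ∀ {z} → z ∈ orbit r → z ∈ above q
        ⊇ z∈ with orbit-∈ z∈
        ... | k , Eq.refl = ∈-above⁺ (σ-rep k r r-rep) (Eq.trans (below-σ k r) r↦q)

    components-over : ∃₂ λ F D → components G (lift Ȳ) ≡ F + p * D × components Q Ȳ ≡ F + D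
    components-over with sum-of-1-or-p p (λ q → length (above q)) CQ.reps (λ q∈ → |above| _ (CQ.reps-rep q∈))
    ... | F , D , Σ≡ , |reps|≡ =
      F , D , Eq.trans CG.components≡reps (Eq.trans (length-by-fibres Fin._≟_ below CG.reps CQ.reps CQ.reps-unique
                                                                      (λ {r} _ → CQ.rep∈reps (CQ.ρ-rep (πV r)))) Σ≡) ,
      Eq.trans CQ.components≡reps |reps|≡

vec-ext : ∀ {X : Set} {k} {u v : Vec X k} → (∀ i → lookup u i ≡ lookup v i) → u ≡ v
vec-ext {u = u} {v} u≗v = Eq.trans (sym (VP.tabulate∘lookup u)) (Eq.trans (VP.tabulate-cong u≗v) (VP.tabulate∘lookup v))

module Rotation (p : ℕ) .{{p≢0 : NonZero p}} where

  next : Fin p → Fin p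
  next k = fromℕ< (m%n<n (suc (toℕ k)) p)

  toℕ-next^ : ∀ j k → toℕ (iterate j next k) ≡ (toℕ k + j) % p
  toℕ-next^ zero    k = sym (Eq.trans (cong (_% p) (ℕP.+-identityʳ (toℕ k))) (m<n⇒m%n≡m (FinP.toℕ<n k)))
  toℕ-next^ (suc j) k = begin
    toℕ (next (iterate j next k))        ≡⟨ FinP.toℕ-fromℕ< (m%n<n (suc (toℕ (iterate j next k))) p) ⟩
    suc (toℕ (iterate j next k)) % p     ≡⟨ cong (λ z → suc z % p) (toℕ-next^ j k) ⟩
    suc ((toℕ k + j) % p) % p            ≡⟨ %-distribˡ-+ 1 ((toℕ k + j) % p) p ⟩
    (1 % p + (toℕ k + j) % p % p) % p    ≡⟨ cong (λ z → (1 % p + z) % p) (m%n%n≡m%n (toℕ k + j) p) ⟩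
    (1 % p + (toℕ k + j) % p) % p        ≡⟨ %-distribˡ-+ 1 (toℕ k + j) p ⟨
    suc (toℕ k + j) % p                  ≡⟨ cong (_% p) (ℕP.+-suc (toℕ k) j) ⟨
    (toℕ k + suc j) % p                  ∎

  next^p : ∀ k → iterate p next k ≡ k
  next^p k = FinP.toℕ-injective (Eq.trans (toℕ-next^ p k)
               (Eq.trans ([m+n]%n≡m%n (toℕ k) p) (m<n⇒m%n≡m (FinP.toℕ<n k))))

  first : Fin p
  first = fromℕ< (>-nonZero⁻¹ p)

  next^-from-0 : ∀ k → iterate (toℕ k) next first ≡ k
  next^-from-0 k = FinP.toℕ-injective (Eq.trans (toℕ-next^ (toℕ k) _)
    (Eq.trans (cong (λ z → (z + toℕ k) % p) (FinP.toℕ-fromℕ< (>-nonZero⁻¹ p))) (m<n⇒m%n≡m (FinP.toℕ<n k))))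

  next-↭ : map next (allFin p) ↭ allFin p
  next-↭ = unique-↭ (Uniq.map⁺ (λ {x} {y} nx≡ny → Eq.trans (sym (back x)) (Eq.trans (cong prev nx≡ny) (back y))) (Uniq.allFin⁺ p))
                    (Uniq.allFin⁺ p) (λ _ → ∈-allFin _)
                    (λ {k} _ → Eq.subst (_∈ map next (allFin p)) (forth k) (∈-map⁺ next (∈-allFin (prev k))))
    where
    prev : Fin p → Fin p
    prev = iterate (p ∸ 1) next
    back : ∀ k → prev (next k) ≡ k
    back k = Eq.trans (sym (iterate-suc next (p ∸ 1) k)) (Eq.trans (cong (λ z → iterate z next k) (ℕP.suc-pred p)) (next^p k))
    forth : ∀ k → next (prev k) ≡ k
    forth k = Eq.trans (cong (λ z → iterate z next k) (ℕP.suc-pred p)) (next^p k)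

  -- rotation of a p-tuple: entry k moves to position k − 1
  rotate : ∀ {X : Set} → Vec X p → Vec X p
  rotate t = tabulate (λ k → lookup t (next k))

  lookup-rotate^ : ∀ {X : Set} j (t : Vec X p) k → lookup (iterate j rotate t) k ≡ lookup t (iterate j next k)
  lookup-rotate^ zero    t k = Eq.refl
  lookup-rotate^ (suc j) t k = Eq.trans (VP.lookup∘tabulate _ k)
    (Eq.trans (lookup-rotate^ j t (next k)) (cong (lookup t) (sym (iterate-suc next j k))))

  rotate^p : ∀ {X : Set} (t : Vec X p) → iterate p rotate t ≡ t
  rotate^p t = vec-ext (λ k → Eq.trans (lookup-rotate^ p t k) (cong (lookup t) (next^p k)))

  rotate-fixed⇒constant : ∀ {X : Set} (t : Vec X p) → rotate t ≡ t → t ≡ Vec.replicate p (lookup t first)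
  rotate-fixed⇒constant t fixed = vec-ext (λ k →
    Eq.trans (cong (lookup t) (sym (next^-from-0 k))) (Eq.trans (along (toℕ k)) (sym (VP.lookup-replicate k _))))
    where
    along : ∀ j → lookup t (iterate j next first) ≡ lookup t first
    along zero    = Eq.refl
    along (suc j) = Eq.trans (sym (VP.lookup∘tabulate (λ k → lookup t (next k)) _))
                             (Eq.trans (cong (λ u → lookup u (iterate j next _)) fixed) (along j))

  sumV-rotate : ∀ {X : Set} (g : X → ℕ) (t : Vec X p) → sumV g (rotate t) ≡ sumV g t
  sumV-rotate g t = begin
    sumV g (rotate t)                                     ≡⟨ sumV-lookup g (rotate t) ⟩
    sum (map (λ k → g (lookup (rotate t) k)) (allFin p))  ≡⟨ cong sum (LP.map-cong (λ k → cong g (VP.lookup∘tabulate _ k)) (allFin p)) ⟩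
    sum (map (λ k → g (lookup t (next k))) (allFin p))    ≡⟨ cong sum (LP.map-∘ (allFin p)) ⟩
    sum (map (λ k → g (lookup t k)) (map next (allFin p))) ≡⟨ sum-↭ (PermP.map⁺ (λ k → g (lookup t k)) next-↭) ⟩
    sum (map (λ k → g (lookup t k)) (allFin p))           ≡⟨ sumV-lookup g t ⟨
    sumV g t                                              ∎

-- Since ⟨h⟩
-- acts freely on edges, every edge of G is h^k(ẽ) for a unique k < p
-- and a unique edge ē of Q, where ẽ is a chosen edge over ē.
module EdgeSlices (p : ℕ) (p-prime : Prime p) (G : Graph) (h : Automorphism G)
                  (periodic : IsPeriodicBy G h p) (Q : Graph) (quotient : IsQuotient G h Q) where
  open IsQuotient quotient

  instance
    p≢0 : NonZero p
    p≢0 = prime⇒nonZero p-prime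

  open Rotation p public

  M M̄ : ℕ
  M = m G
  M̄ = m Q

  hᴱ : Fin M → Fin M
  hᴱ = fE h

  hⱽᵖ≡id : ∀ v → iterate p (fV h) v ≡ v
  hⱽᵖ≡id = proj₁ (proj₁ (proj₂ (proj₁ periodic)))

  hᴱᵖ≡id : ∀ e → iterate p hᴱ e ≡ e
  hᴱᵖ≡id = proj₂ (proj₁ (proj₂ (proj₁ periodic)))

  hᴱ-free : EdgeFree h p
  hᴱ-free = proj₂ periodic

  πE-iterate : ∀ k e → πE (iterate k hᴱ e) ≡ πE e
  πE-iterate k e = sym (πE-orbit₂ e _ k Eq.refl)

  base : Fin M̄ → Fin M
  base ē = proj₁ (πE-surj ē)

  π-base : ∀ ē → πE (base ē) ≡ ē
  π-base ē = proj₂ (πE-surj ē)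

  -- h^b e ≠ h^a e for a < b < p, since h^(b-a) fixes no edge
  no-return : ∀ e {a b} → a < b → b < p → iterate b hᴱ e ≡ iterate a hᴱ e → ⊥
  no-return e {a} {b} a<b b<p hᵇe≡hᵃe =
    hᴱ-free (b ∸ a) (ℕP.m<n⇒0<n∸m a<b) (ℕP.≤-<-trans (ℕP.m∸n≤m b a) b<p) (iterate a hᴱ e)
      (Eq.trans (sym (iterate-+ hᴱ (b ∸ a) a e))
                (Eq.trans (cong (λ z → iterate z hᴱ e) (ℕP.m∸n+n≡m (ℕP.<⇒≤ a<b))) hᵇe≡hᵃe))

  iterate-injective : ∀ {i j} e → i < p → j < p → iterate i hᴱ e ≡ iterate j hᴱ e → i ≡ j
  iterate-injective {i} {j} e i<p j<p hⁱe≡hʲe with ℕP.<-cmp i j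
  ... | tri< i<j _ _ = ⊥-elim (no-return e i<j j<p (sym hⁱe≡hʲe))
  ... | tri≈ _ i≡j _ = i≡j
  ... | tri> _ _ i>j = ⊥-elim (no-return e i>j i<p hⁱe≡hʲe)

  private module EdgeOrbits = Orbits Fin._≟_ hᴱ p p-prime

  slice : Fin M → Fin p
  slice e = fromℕ< (m%n<n (proj₁ (πE-orbit₁ (base (πE e)) e (π-base (πE e)))) p)

  slice-spec : ∀ e → iterate (toℕ (slice e)) hᴱ (base (πE e)) ≡ e
  slice-spec e = let (k , hᵏẽ≡e) = πE-orbit₁ (base (πE e)) e (π-base (πE e)) in
    Eq.trans (cong (λ z → iterate z hᴱ (base (πE e))) (FinP.toℕ-fromℕ< (m%n<n k p)))
             (Eq.trans (sym (EdgeOrbits.iterate-mod k (base (πE e)) (hᴱᵖ≡id _))) hᵏẽ≡e)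

  slice-unique : ∀ e (k : Fin p) → iterate (toℕ k) hᴱ (base (πE e)) ≡ e → slice e ≡ k
  slice-unique e k hᵏẽ≡e = FinP.toℕ-injective
    (iterate-injective (base (πE e)) (FinP.toℕ<n (slice e)) (FinP.toℕ<n k) (Eq.trans (slice-spec e) (sym hᵏẽ≡e)))

  slice-hᴱ : ∀ e → slice (hᴱ e) ≡ next (slice e)
  slice-hᴱ e = slice-unique (hᴱ e) (next (slice e)) (begin
    iterate (toℕ (next (slice e))) hᴱ (base (πE (hᴱ e)))
      ≡⟨ cong (λ ē → iterate (toℕ (next (slice e))) hᴱ (base ē)) (πE-iterate 1 e) ⟩
    iterate (toℕ (next (slice e))) hᴱ (base (πE e))
      ≡⟨ cong (λ z → iterate z hᴱ (base (πE e))) (FinP.toℕ-fromℕ< (m%n<n (suc (toℕ (slice e))) p)) ⟩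
    iterate (suc (toℕ (slice e)) % p) hᴱ (base (πE e))
      ≡⟨ EdgeOrbits.iterate-mod (suc (toℕ (slice e))) (base (πE e)) (hᴱᵖ≡id _) ⟨
    hᴱ (iterate (toℕ (slice e)) hᴱ (base (πE e)))
      ≡⟨ cong hᴱ (slice-spec e) ⟩
    hᴱ e ∎)

  φ : Fin p × Fin M̄ → Fin M
  φ (k , ē) = iterate (toℕ k) hᴱ (base ē)

  π-φ : ∀ k ē → πE (φ (k , ē)) ≡ ē
  π-φ k ē = Eq.trans (πE-iterate (toℕ k) (base ē)) (π-base ē)

  slice-φ : ∀ k ē → slice (φ (k , ē)) ≡ k
  slice-φ k ē = slice-unique (φ (k , ē)) k (cong (λ ē' → iterate (toℕ k) hᴱ (base ē')) (π-φ k ē))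

  φ-↭ : map φ (cartesianProduct (allFin p) (allFin M̄)) ↭ allFin M
  φ-↭ = unique-↭ (Uniq.map⁺ injective (Uniq.cartesianProduct⁺ (Uniq.allFin⁺ p) (Uniq.allFin⁺ M̄)))
                 (Uniq.allFin⁺ M) (λ _ → ∈-allFin _)
                 (λ {e} _ → Eq.subst (_∈ _) (slice-spec e) (∈-map⁺ φ (∈-cartesianProduct⁺ (∈-allFin (slice e)) (∈-allFin (πE e)))))
    where
    injective : ∀ {x y} → φ x ≡ φ y → x ≡ y
    injective {k , ē} {k' , ē'} φx≡φy =
      cong₂ _,_ (Eq.trans (sym (slice-φ k ē)) (Eq.trans (cong slice φx≡φy) (slice-φ k' ē')))
                (Eq.trans (sym (π-φ k ē)) (Eq.trans (cong πE φx≡φy) (π-φ k' ē')))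

  Tuple : Set
  Tuple = Vec (Subset M̄) p

  assemble : Tuple → Subset M
  assemble t = tabulate (λ e → lookup (lookup t (slice e)) (πE e))

  lookup-assemble : ∀ t e → lookup (assemble t) e ≡ lookup (lookup t (slice e)) (πE e)
  lookup-assemble t e = VP.lookup∘tabulate _ e

  assemble-φ : ∀ t k ē → lookup (assemble t) (φ (k , ē)) ≡ lookup (lookup t k) ē
  assemble-φ t k ē = Eq.trans (lookup-assemble t _) (cong₂ (λ k' ē' → lookup (lookup t k') ē') (slice-φ k ē) (π-φ k ē))

  split : Subset M → Tuple
  split Y = tabulate (λ k → tabulate (λ ē → lookup Y (φ (k , ē))))

  assemble-split : ∀ Y → assemble (split Y) ≡ Y
  assemble-split Y = vec-ext (λ e → Eq.trans (lookup-assemble (split Y) e)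
    (Eq.trans (cong (λ s → lookup s (πE e)) (VP.lookup∘tabulate _ (slice e)))
              (Eq.trans (VP.lookup∘tabulate _ (πE e)) (cong (lookup Y) (slice-spec e)))))

  split-assemble : ∀ t → split (assemble t) ≡ t
  split-assemble t = vec-ext (λ k → Eq.trans (VP.lookup∘tabulate _ k)
    (vec-ext (λ ē → Eq.trans (VP.lookup∘tabulate _ ē) (assemble-φ t k ē))))

  tuples : List Tuple
  tuples = vectors (allSubsets M̄) p

  tuples-unique : Unique tuples
  tuples-unique = vectors-unique (allSubsets M̄) p (allSubsets-unique M̄)

  tuples-complete : ∀ t → t ∈ tuples
  tuples-complete = vectors-complete (allSubsets M̄) p (allSubsets-complete M̄)

  assemble-↭ : map assemble tuples ↭ allSubsets M
  assemble-↭ = unique-↭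
    (Uniq.map⁺ (λ {t} {t'} eq → Eq.trans (sym (split-assemble t)) (Eq.trans (cong split eq) (split-assemble t'))) tuples-unique)
    (allSubsets-unique M) (λ _ → allSubsets-complete M _)
    (λ {Y} _ → Eq.subst (_∈ map assemble tuples) (assemble-split Y) (∈-map⁺ assemble (tuples-complete (split Y))))

  countᵇ-assemble : ∀ (f : Bool → Bool) t →
    countᵇ (λ e → f (lookup (assemble t) e)) (allFin M) ≡ sumV (λ s → countᵇ (λ ē → f (lookup s ē)) (allFin M̄)) t
  countᵇ-assemble f t = begin
    countᵇ (λ e → f (lookup (assemble t) e)) (allFin M)
      ≡⟨ countᵇ-↭ _ φ-↭ ⟨
    countᵇ (λ e → f (lookup (assemble t) e)) (map φ (cartesianProduct (allFin p) (allFin M̄)))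
      ≡⟨ countᵇ-map (λ e → f (lookup (assemble t) e)) φ (cartesianProduct (allFin p) (allFin M̄)) ⟩
    countᵇ (λ x → f (lookup (assemble t) (φ x))) (cartesianProduct (allFin p) (allFin M̄))
      ≡⟨ countᵇ-cartesian _ (allFin p) (allFin M̄) ⟩
    sum (map (λ k → countᵇ (λ ē → f (lookup (assemble t) (φ (k , ē)))) (allFin M̄)) (allFin p))
      ≡⟨ cong sum (LP.map-cong (λ k → countᵇ-cong (λ ē → cong f (assemble-φ t k ē)) (allFin M̄)) (allFin p)) ⟩
    sum (map (λ k → countᵇ (λ ē → f (lookup (lookup t k) ē)) (allFin M̄)) (allFin p))
      ≡⟨ sumV-lookup _ t ⟨
    sumV (λ s → countᵇ (λ ē → f (lookup s ē)) (allFin M̄)) t ∎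

  sizeY-assemble : ∀ t → sizeY G (assemble t) ≡ sumV (sizeY Q) t
  sizeY-assemble t = Eq.trans (count≡countᵇ (assemble t))
    (Eq.trans (countᵇ-assemble (λ b → b) t) (sumV-cong (λ s → sym (count≡countᵇ s)) t))

  unselected-assemble : ∀ t → M ∸ sizeY G (assemble t) ≡ sumV (λ s → M̄ ∸ sizeY Q s) t
  unselected-assemble t = Eq.trans (∸-count≡countᵇ-not (assemble t))
    (Eq.trans (countᵇ-assemble not t) (sumV-cong (λ s → sym (∸-count≡countᵇ-not s)) t))

  assemble-rotate : ∀ t e → lookup (assemble (rotate t)) e ≡ lookup (assemble t) (hᴱ e)
  assemble-rotate t e = begin
    lookup (assemble (rotate t)) e                 ≡⟨ lookup-assemble (rotate t) e ⟩
    lookup (lookup (rotate t) (slice e)) (πE e)    ≡⟨ cong (λ s → lookup s (πE e)) (VP.lookup∘tabulate _ (slice e)) ⟩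
    lookup (lookup t (next (slice e))) (πE e)      ≡⟨ cong₂ (λ k ē → lookup (lookup t k) ē) (slice-hᴱ e) (πE-iterate 1 e) ⟨
    lookup (lookup t (slice (hᴱ e))) (πE (hᴱ e))   ≡⟨ lookup-assemble t (hᴱ e) ⟨
    lookup (assemble t) (hᴱ e)                     ∎

  components-rotate : ∀ t → components G (assemble (rotate t)) ≡ components G (assemble t)
  components-rotate t = components-automorphism G h (assemble (rotate t)) (assemble t) (assemble-rotate t)

module Main (p : ℕ) (p-prime : Prime p) (G : Graph) (h : Automorphism G)
            (periodic : IsPeriodicBy G h p) (Q : Graph) (quotient : IsQuotient G h Q) where
  open EdgeSlices p p-prime G h periodic Q quotient
  open QuotientComponents p p-prime G h hⱽᵖ≡id Q quotient
  open ModIdeal p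
  open IsQuotient quotient using (πE)

  termQ : Subset M̄ → Monomial
  termQ s = (+ 1 , components Q s , M̄ ∸ sizeY Q s , sizeY Q s)

  termQ* : ∀ {k} → Vec (Subset M̄) k → Monomial
  termQ* Vec.[]       = (+ 1 , 0 , 0 , 0)
  termQ* (s Vec.∷ t) = mulₘ (termQ s) (termQ* t)

  termQ*-exponents : ∀ {k} (t : Vec (Subset M̄) k) →
    termQ* t ≡ (+ 1 , sumV (components Q) t , sumV (λ s → M̄ ∸ sizeY Q s) t , sumV (sizeY Q) t)
  termQ*-exponents Vec.[]       = Eq.refl
  termQ*-exponents (s Vec.∷ t) = cong (mulₘ (termQ s)) (termQ*-exponents t)

  Negami-power : ∀ k → Negami Q ^ₚ k ≡ map termQ* (vectors (allSubsets M̄) k)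
  Negami-power zero    = Eq.refl
  Negami-power (suc k) = Eq.trans (cong (Negami Q *ₚ_) (Negami-power k)) (expand (allSubsets M̄))
    where
    Ts : List (Vec (Subset M̄) k)
    Ts = vectors (allSubsets M̄) k
    expand : ∀ ss → (map termQ ss *ₚ map termQ* Ts) ≡ map termQ* (cartesianProductWith Vec._∷_ ss Ts)
    expand []       = Eq.refl
    expand (s ∷ ss) = begin
      (map termQ (s ∷ ss) *ₚ map termQ* Ts)                               ≡⟨ *-∷ (termQ s) (map termQ ss) (map termQ* Ts) ⟩
      map (mulₘ (termQ s)) (map termQ* Ts) ++ (map termQ ss *ₚ map termQ* Ts) ≡⟨ cong₂ _++_ (sym (LP.map-∘ Ts)) (expand ss) ⟩
      map (λ t → termQ* (s Vec.∷ t)) Ts ++ map termQ* (cartesianProductWith Vec._∷_ ss Ts)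
                                                                          ≡⟨ cong (_++ _) (LP.map-∘ Ts) ⟩
      map termQ* (map (s Vec.∷_) Ts) ++ map termQ* (cartesianProductWith Vec._∷_ ss Ts)
                                                                          ≡⟨ LP.map-++ termQ* (map (s Vec.∷_) Ts) _ ⟨
      map termQ* (cartesianProductWith Vec._∷_ (s ∷ ss) Ts)                ∎

  termG : Tuple → Monomial
  termG t = (+ 1 , components G (assemble t) , M ∸ sizeY G (assemble t) , sizeY G (assemble t))

  termG-exponents : ∀ t →
    termG t ≡ (+ 1 , components G (assemble t) , sumV (λ s → M̄ ∸ sizeY Q s) t , sumV (sizeY Q) t)
  termG-exponents t = cong₂ (λ b c → (+ 1 , components G (assemble t) , b , c)) (unselected-assemble t) (sizeY-assemble t)

  Negami-G : Negami G ↭ map termG tuples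
  Negami-G = ↭-trans (PermP.map⁺ termOf (↭-sym assemble-↭)) (↭-reflexive (sym (LP.map-∘ tuples)))
    where
    termOf : Subset M → Monomial
    termOf Y = (+ 1 , components G Y , M ∸ sizeY G Y , sizeY G Y)

  termG-rotate : ∀ t → termG (rotate t) ≡ termG t
  termG-rotate t = Eq.trans (termG-exponents (rotate t)) (Eq.trans
    (cong₂ (λ a bc → (+ 1 , a , bc)) (components-rotate t) (cong₂ _,_ (sumV-rotate _ t) (sumV-rotate _ t)))
    (sym (termG-exponents t)))

  termQ*-rotate : ∀ t → termQ* (rotate t) ≡ termQ* t
  termQ*-rotate t = Eq.trans (termQ*-exponents (rotate t)) (Eq.trans
    (cong₂ (λ a bc → (+ 1 , a , bc)) (sumV-rotate _ t) (cong₂ _,_ (sumV-rotate _ t) (sumV-rotate _ t)))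
    (sym (termQ*-exponents t)))

  -- At a fixed tuple (s, …, s) the edge set is π⁻¹(s), so the u-exponents
  -- are F + p·D for G and p·(F + D) for Q^p.
  termG≡termQ*-fixed : ∀ t → rotate t ≡ t → (termG t ∷ []) ≡ᵢ (termQ* t ∷ [])
  termG≡termQ*-fixed t fixed =
    Eq.subst₂ _≡ᵢ_ (cong (_∷ []) (sym (termG-exponents t))) (cong (_∷ []) (sym (termQ*-exponents t)))
      (Eq.subst₂ (λ a a' → mono a J K ≡ᵢ mono a' J K) (sym wG) (sym wQ) (u-exponents F D J K))
    where
    s = lookup t first
    t≡s* : t ≡ Vec.replicate p s
    t≡s* = rotate-fixed⇒constant t fixed
    assemble≡lift : assemble t ≡ lift s
    assemble≡lift = vec-ext (λ e → Eq.trans (lookup-assemble t e)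
      (Eq.trans (cong (λ u → lookup (lookup u (slice e)) (πE e)) t≡s*)
        (Eq.trans (cong (λ u → lookup u (πE e)) (VP.lookup-replicate (slice e) s)) (sym (VP.lookup∘tabulate _ e)))))
    F = proj₁ (components-over s)
    D = proj₁ (proj₂ (components-over s))
    J = sumV (λ s → M̄ ∸ sizeY Q s) t
    K = sumV (sizeY Q) t
    wG : components G (assemble t) ≡ F + p * D
    wG = Eq.trans (cong (components G) assemble≡lift) (proj₁ (proj₂ (proj₂ (components-over s))))
    wQ : sumV (components Q) t ≡ p * (F + D)
    wQ = Eq.trans (cong (sumV (components Q)) t≡s*)
           (Eq.trans (sumV-replicate (components Q) p s) (cong (p *_) (proj₂ (proj₂ (proj₂ (components-over s))))))

  -- N_G ≡ N_Q^p: reindex both sides by tuples, then sum over rotation orbits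
  theorem : Negami G ≡ᵢ (Negami Q ^ₚ p)
  theorem = ≡ᵢ-trans (≈ₚ⇒≡ᵢ (↭⇒≈ₚ Negami-G))
    (≡ᵢ-trans (OrbitSums.orbit-sum (VP.≡-dec (VP.≡-dec BP._≟_)) rotate p p-prime
                 tuples tuples-unique (λ {t} _ → tuples-complete (rotate t)) rotate^p
                 termG termQ* termG-rotate termQ*-rotate termG≡termQ*-fixed)
              (≈ₚ⇒≡ᵢ (λ a b c → cong (λ f → coeff f a b c) (sym (Negami-power p)))))

theorem3p1 : (p : ℕ) → Prime p → (G : Graph) → Connected G → (h : Automorphism G) → IsPeriodicBy G h p → (Q : Graph) → IsQuotient G h Q → CongModPU p (Negami G) (Negami Q ^ₚ p)
theorem3p1 p p-prime G _ h periodic Q quotient = ModIdeal.≡ᵢ⇒CongModPU p (Main.theorem p p-prime G h periodic Q quotient)
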